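{- There is a constant $c$ such that for every quantifier-free formula $\varphi$ in the language $L$ expanded by the division symbol, of length $l$, there is a quantifier-free formula $\varphi'$ of $L$ (not containing the division symbol) of length at most $2^{cl}$ such that $T\vdash\varphi\leftrightarrow\varphi'$.
   Context: Let $L$ be the language with constant symbols $0,1$, binary function symbols $+,-,\times$, the binary relation $<$, a unary function symbol $\lambda$, a unary predicate $A$, and unary predicates $D_n$ for each integer $n\ge 1$. Let $T$ be the $L$-theory consisting of the axioms of real closed ordered fields together with: $\forall x(A(x)\to x>0)$; $\forall x,y(A(x)\to(A(y)\leftrightarrow A(xy)))$; $A(2)\wedge\forall x(1<x<2\to\neg A(x))$; $\forall x(x>0\to\exists y(A(y)\wedge y\le x<2y))$; for each $n\ge1$, $\forall x(D_n(x)\leftrightarrow\exists y(A(y)\wedge y^n=x))$; $\forall x(x\le 0\to\lambda(x)=0)$; $\forall x(x>0\to A(\lambda(x))\wedge\lambda(x)\le x<2\lambda(x))$. Here $2$ abbreviates $1+1$. The division symbol $/$ is a binary function symbol defined in $T$ by $x/y=z\leftrightarrow((y\neq0\wedge x=yz)\vee(y=0\wedge z=0))$. The length of a formula is the number of symbols in a reasonable formulation of the first-order language, except that each symbol $D_n$ counts as having length $n$. -}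

module Defs where

open import Data.Nat using (ℕ; zero; suc; _+_; _*_; _^_; _≤_)
open import Data.Fin using (Fin; zero; suc; toℕ)
open import Data.List using (List; []; _∷_; map)
open import Data.List.Membership.Propositional using (_∈_)
open import Data.Empty using (⊥)
open import Data.Unit using (⊤)
open import Data.Product using (_×_)
open import Function using (_∘_)

infixl 6 _⊕_ _⊖_
infixl 7 _⊗_ _⊘_
infix 4 _≐_ _≺_

data Tm (n : ℕ) : Set where
  var         : Fin n → Tm n
  c0 c1       : Tm n
  _⊕_ _⊖_ _⊗_ : Tm n → Tm n → Tm n
  lam         : Tm n → Tm n
  _⊘_         : Tm n → Tm n → Tm n

infixr 3 _⟶_ _⟺_
infixr 4 _∨'_
infixr 5 _∧'_

data Fm (n : ℕ) : Set where
  ⊤' ⊥'         : Fm n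
  _≐_ _≺_        : Tm n → Tm n → Fm n
  Ap             : Tm n → Fm n
  Dp             : (k : ℕ) → Tm n → Fm n  -- Dp k t  is  D_{k+1}(t)
  ¬'_            : Fm n → Fm n
  _∧'_ _∨'_ _⟶_ _⟺_ : Fm n → Fm n → Fm n
  all ex         : Fm (suc n) → Fm n

data DivFreeT {n} : Tm n → Set where
  qvar : ∀ i → DivFreeT (var i)
  qc0  : DivFreeT c0
  qc1  : DivFreeT c1
  q⊕   : ∀ {s t} → DivFreeT s → DivFreeT t → DivFreeT (s ⊕ t)
  q⊖   : ∀ {s t} → DivFreeT s → DivFreeT t → DivFreeT (s ⊖ t)
  q⊗   : ∀ {s t} → DivFreeT s → DivFreeT t → DivFreeT (s ⊗ t)
  qlam : ∀ {t} → DivFreeT t → DivFreeT (lam t)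

data QF {n} : Fm n → Set where
  q⊤' : QF ⊤'
  q⊥' : QF ⊥'
  q≐  : ∀ s t → QF (s ≐ t)
  q≺  : ∀ s t → QF (s ≺ t)
  qAp : ∀ t → QF (Ap t)
  qDp : ∀ k t → QF (Dp k t)
  q¬' : ∀ {φ} → QF φ → QF (¬' φ)
  q∧' : ∀ {φ ψ} → QF φ → QF ψ → QF (φ ∧' ψ)
  q∨' : ∀ {φ ψ} → QF φ → QF ψ → QF (φ ∨' ψ)
  q⟶  : ∀ {φ ψ} → QF φ → QF ψ → QF (φ ⟶ ψ)
  q⟺  : ∀ {φ ψ} → QF φ → QF ψ → QF (φ ⟺ ψ)

data DivFree {n} : Fm n → Set where
  q⊤'  : DivFree ⊤'
  q⊥'  : DivFree ⊥'
  q≐   : ∀ {s t} → DivFreeT s → DivFreeT t → DivFree (s ≐ t)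
  q≺   : ∀ {s t} → DivFreeT s → DivFreeT t → DivFree (s ≺ t)
  qAp  : ∀ {t} → DivFreeT t → DivFree (Ap t)
  qDp  : ∀ k {t} → DivFreeT t → DivFree (Dp k t)
  q¬'  : ∀ {φ} → DivFree φ → DivFree (¬' φ)
  q∧'  : ∀ {φ ψ} → DivFree φ → DivFree ψ → DivFree (φ ∧' ψ)
  q∨'  : ∀ {φ ψ} → DivFree φ → DivFree ψ → DivFree (φ ∨' ψ)
  q⟶   : ∀ {φ ψ} → DivFree φ → DivFree ψ → DivFree (φ ⟶ ψ)
  q⟺   : ∀ {φ ψ} → DivFree φ → DivFree ψ → DivFree (φ ⟺ ψ)
  qall : ∀ {φ} → DivFree φ → DivFree (all φ)
  qex  : ∀ {φ} → DivFree φ → DivFree (ex φ)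

-- Length: number of symbols (prefix/Polish notation), where the
-- symbol D_n counts as n.  A quantifier with its bound variable counts 2.

lenT : ∀ {n} → Tm n → ℕ
lenT (var i) = 1
lenT c0 = 1
lenT c1 = 1
lenT (s ⊕ t) = suc (lenT s + lenT t)
lenT (s ⊖ t) = suc (lenT s + lenT t)
lenT (s ⊗ t) = suc (lenT s + lenT t)
lenT (lam t) = suc (lenT t)
lenT (s ⊘ t) = suc (lenT s + lenT t)

len : ∀ {n} → Fm n → ℕ
len ⊤' = 1
len ⊥' = 1
len (s ≐ t) = suc (lenT s + lenT t)
len (s ≺ t) = suc (lenT s + lenT t)
len (Ap t) = suc (lenT t)
len (Dp k t) = suc k + lenT t
len (¬' φ) = suc (len φ)
len (φ ∧' ψ) = suc (len φ + len ψ)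
len (φ ∨' ψ) = suc (len φ + len ψ)
len (φ ⟶ ψ) = suc (len φ + len ψ)
len (φ ⟺ ψ) = suc (len φ + len ψ)
len (all φ) = 2 + len φ
len (ex φ) = 2 + len φ

ext : ∀ {n m} → (Fin n → Fin m) → Fin (suc n) → Fin (suc m)
ext ρ zero = zero
ext ρ (suc i) = suc (ρ i)

renT : ∀ {n m} → (Fin n → Fin m) → Tm n → Tm m
renT ρ (var i) = var (ρ i)
renT ρ c0 = c0
renT ρ c1 = c1
renT ρ (s ⊕ t) = renT ρ s ⊕ renT ρ t
renT ρ (s ⊖ t) = renT ρ s ⊖ renT ρ t
renT ρ (s ⊗ t) = renT ρ s ⊗ renT ρ t
renT ρ (lam t) = lam (renT ρ t)
renT ρ (s ⊘ t) = renT ρ s ⊘ renT ρ t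

renF : ∀ {n m} → (Fin n → Fin m) → Fm n → Fm m
renF ρ ⊤' = ⊤'
renF ρ ⊥' = ⊥'
renF ρ (s ≐ t) = renT ρ s ≐ renT ρ t
renF ρ (s ≺ t) = renT ρ s ≺ renT ρ t
renF ρ (Ap t) = Ap (renT ρ t)
renF ρ (Dp k t) = Dp k (renT ρ t)
renF ρ (¬' φ) = ¬' renF ρ φ
renF ρ (φ ∧' ψ) = renF ρ φ ∧' renF ρ ψ
renF ρ (φ ∨' ψ) = renF ρ φ ∨' renF ρ ψ
renF ρ (φ ⟶ ψ) = renF ρ φ ⟶ renF ρ ψ
renF ρ (φ ⟺ ψ) = renF ρ φ ⟺ renF ρ ψ
renF ρ (all φ) = all (renF (ext ρ) φ)
renF ρ (ex φ) = ex (renF (ext ρ) φ)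

exts : ∀ {n m} → (Fin n → Tm m) → Fin (suc n) → Tm (suc m)
exts σ zero = var zero
exts σ (suc i) = renT suc (σ i)

subT : ∀ {n m} → (Fin n → Tm m) → Tm n → Tm m
subT σ (var i) = σ i
subT σ c0 = c0
subT σ c1 = c1
subT σ (s ⊕ t) = subT σ s ⊕ subT σ t
subT σ (s ⊖ t) = subT σ s ⊖ subT σ t
subT σ (s ⊗ t) = subT σ s ⊗ subT σ t
subT σ (lam t) = lam (subT σ t)
subT σ (s ⊘ t) = subT σ s ⊘ subT σ t

subF : ∀ {n m} → (Fin n → Tm m) → Fm n → Fm m
subF σ ⊤' = ⊤'
subF σ ⊥' = ⊥'
subF σ (s ≐ t) = subT σ s ≐ subT σ t
subF σ (s ≺ t) = subT σ s ≺ subT σ t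
subF σ (Ap t) = Ap (subT σ t)
subF σ (Dp k t) = Dp k (subT σ t)
subF σ (¬' φ) = ¬' subF σ φ
subF σ (φ ∧' ψ) = subF σ φ ∧' subF σ ψ
subF σ (φ ∨' ψ) = subF σ φ ∨' subF σ ψ
subF σ (φ ⟶ ψ) = subF σ φ ⟶ subF σ ψ
subF σ (φ ⟺ ψ) = subF σ φ ⟺ subF σ ψ
subF σ (all φ) = all (subF (exts σ) φ)
subF σ (ex φ) = ex (subF (exts σ) φ)

_[_] : ∀ {n} → Fm (suc n) → Tm n → Fm n
φ [ t ] = subF (λ { zero → t ; (suc i) → var i }) φ

wkF : ∀ {n} → Fm n → Fm (suc n)
wkF = renF suc

closed : ∀ {n} → Fm 0 → Fm n
closed = renF (λ ())

x₀ : ∀ {n} → Tm (suc n)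
x₀ = var zero
x₁ : ∀ {n} → Tm (suc (suc n))
x₁ = var (suc zero)
x₂ : ∀ {n} → Tm (suc (suc (suc n)))
x₂ = var (suc (suc zero))

two : ∀ {n} → Tm n
two = c1 ⊕ c1

_≼_ : ∀ {n} → Tm n → Tm n → Fm n
s ≼ t = (s ≺ t) ∨' (s ≐ t)

pow : ∀ {n} → Tm n → ℕ → Tm n
pow t zero = c1
pow t (suc k) = pow t k ⊗ t

sumFin : ∀ {k} m → (Fin m → Tm k) → Tm k
sumFin zero f = c0
sumFin (suc m) f = f zero ⊕ sumFin m (f ∘ suc)

allN : ∀ m {n} → Fm (m + n) → Fm n
allN zero φ = φ
allN (suc m) φ = allN m (all φ)

-- ∀ a_0 … a_{d-1} ∃ x ( a_0 x^0 + … + a_{d-1} x^{d-1} + x^d = 0 )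
oddRoot : ℕ → Fm 0
oddRoot d = allN d (ex (sumFin (d + 0) (λ i → var (suc i) ⊗ pow x₀ (toℕ i))
                         ⊕ pow x₀ d ≐ c0))

data Ax : Fm 0 → Set where
  add-assoc : Ax (all (all (all ((x₂ ⊕ x₁) ⊕ x₀ ≐ x₂ ⊕ (x₁ ⊕ x₀)))))
  add-comm  : Ax (all (all (x₁ ⊕ x₀ ≐ x₀ ⊕ x₁)))
  add-zero  : Ax (all (x₀ ⊕ c0 ≐ x₀))
  sub-def   : Ax (all (all ((x₁ ⊖ x₀) ⊕ x₀ ≐ x₁)))
  mul-assoc : Ax (all (all (all ((x₂ ⊗ x₁) ⊗ x₀ ≐ x₂ ⊗ (x₁ ⊗ x₀)))))
  mul-comm  : Ax (all (all (x₁ ⊗ x₀ ≐ x₀ ⊗ x₁)))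
  mul-one   : Ax (all (x₀ ⊗ c1 ≐ x₀))
  distrib   : Ax (all (all (all (x₂ ⊗ (x₁ ⊕ x₀) ≐ (x₂ ⊗ x₁) ⊕ (x₂ ⊗ x₀)))))
  mul-inv   : Ax (all ((¬' (x₀ ≐ c0)) ⟶ ex (x₁ ⊗ x₀ ≐ c1)))
  zero≠one  : Ax (¬' (c0 ≐ c1))
  lt-irrefl : Ax (all (¬' (x₀ ≺ x₀)))
  lt-trans  : Ax (all (all (all ((x₂ ≺ x₁) ∧' (x₁ ≺ x₀) ⟶ x₂ ≺ x₀))))
  lt-total  : Ax (all (all ((x₁ ≺ x₀) ∨' (x₁ ≐ x₀) ∨' (x₀ ≺ x₁))))
  lt-add    : Ax (all (all (all ((x₂ ≺ x₁) ⟶ x₂ ⊕ x₀ ≺ x₁ ⊕ x₀))))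
  lt-mul    : Ax (all (all ((c0 ≺ x₁) ∧' (c0 ≺ x₀) ⟶ c0 ≺ x₁ ⊗ x₀)))
  sqrt      : Ax (all ((c0 ≺ x₀) ⟶ ex (x₀ ⊗ x₀ ≐ x₁)))
  odd-root  : ∀ k → Ax (oddRoot (suc (2 * k)))
  A-pos     : Ax (all (Ap x₀ ⟶ c0 ≺ x₀))
  A-mul     : Ax (all (all (Ap x₁ ⟶ (Ap x₀ ⟺ Ap (x₁ ⊗ x₀)))))
  A-two     : Ax (Ap two ∧' all ((c1 ≺ x₀) ∧' (x₀ ≺ two) ⟶ ¬' Ap x₀))
  A-approx  : Ax (all ((c0 ≺ x₀) ⟶ ex (Ap x₀ ∧' (x₀ ≼ x₁) ∧' (x₁ ≺ two ⊗ x₀))))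
  D-def     : ∀ k → Ax (all (Dp k x₀ ⟺ ex (Ap x₀ ∧' (pow x₀ (suc k) ≐ x₁))))
  lam-nonpos : Ax (all ((x₀ ≼ c0) ⟶ lam x₀ ≐ c0))
  lam-pos   : Ax (all ((c0 ≺ x₀) ⟶ Ap (lam x₀) ∧' (lam x₀ ≼ x₀) ∧' (x₀ ≺ two ⊗ lam x₀)))
  div-def   : Ax (all (all (all ((x₂ ⊘ x₁ ≐ x₀) ⟺
                 (((¬' (x₁ ≐ c0)) ∧' (x₂ ≐ x₁ ⊗ x₀)) ∨' ((x₁ ≐ c0) ∧' (x₀ ≐ c0)))))))

infix 2 _⊢_

data _⊢_ {n} (Γ : List (Fm n)) : Fm n → Set where
  hyp  : ∀ {φ} → φ ∈ Γ → Γ ⊢ φ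
  ax   : ∀ {ψ} → Ax ψ → Γ ⊢ closed ψ
  ⊤I   : Γ ⊢ ⊤'
  ⊥E   : ∀ {φ} → Γ ⊢ ⊥' → Γ ⊢ φ
  raa  : ∀ {φ} → (¬' φ ∷ Γ) ⊢ ⊥' → Γ ⊢ φ
  ¬I   : ∀ {φ} → (φ ∷ Γ) ⊢ ⊥' → Γ ⊢ ¬' φ
  ¬E   : ∀ {φ} → Γ ⊢ ¬' φ → Γ ⊢ φ → Γ ⊢ ⊥'
  ∧I   : ∀ {φ ψ} → Γ ⊢ φ → Γ ⊢ ψ → Γ ⊢ φ ∧' ψ
  ∧E₁  : ∀ {φ ψ} → Γ ⊢ φ ∧' ψ → Γ ⊢ φ
  ∧E₂  : ∀ {φ ψ} → Γ ⊢ φ ∧' ψ → Γ ⊢ ψ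
  ∨I₁  : ∀ {φ ψ} → Γ ⊢ φ → Γ ⊢ φ ∨' ψ
  ∨I₂  : ∀ {φ ψ} → Γ ⊢ ψ → Γ ⊢ φ ∨' ψ
  ∨E   : ∀ {φ ψ χ} → Γ ⊢ φ ∨' ψ → (φ ∷ Γ) ⊢ χ → (ψ ∷ Γ) ⊢ χ → Γ ⊢ χ
  ⟶I   : ∀ {φ ψ} → (φ ∷ Γ) ⊢ ψ → Γ ⊢ φ ⟶ ψ
  ⟶E   : ∀ {φ ψ} → Γ ⊢ φ ⟶ ψ → Γ ⊢ φ → Γ ⊢ ψ
  ⟺I   : ∀ {φ ψ} → (φ ∷ Γ) ⊢ ψ → (ψ ∷ Γ) ⊢ φ → Γ ⊢ φ ⟺ ψ
  ⟺E₁  : ∀ {φ ψ} → Γ ⊢ φ ⟺ ψ → Γ ⊢ φ → Γ ⊢ ψ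
  ⟺E₂  : ∀ {φ ψ} → Γ ⊢ φ ⟺ ψ → Γ ⊢ ψ → Γ ⊢ φ
  allI : ∀ {φ} → map wkF Γ ⊢ φ → Γ ⊢ all φ
  allE : ∀ {φ} → Γ ⊢ all φ → (t : Tm n) → Γ ⊢ φ [ t ]
  exI  : ∀ {φ} (t : Tm n) → Γ ⊢ φ [ t ] → Γ ⊢ ex φ
  exE  : ∀ {φ ψ} → Γ ⊢ ex φ → (φ ∷ map wkF Γ) ⊢ wkF ψ → Γ ⊢ ψ
  refl= : ∀ (t : Tm n) → Γ ⊢ t ≐ t
  subst= : ∀ {s t} (φ : Fm (suc n)) → Γ ⊢ s ≐ t → Γ ⊢ φ [ s ] → Γ ⊢ φ [ t ]

_⊢T_ : ∀ n → Fm n → Set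
n ⊢T φ = ([] {A = Fm n}) ⊢ φ

-- Every term t is, after case distinctions on division-free conditions, a fraction p/q of
-- division-free terms with q ≠ 0: sums, differences and products of fractions are fractions, a
-- quotient is one after splitting on whether the divisor's numerator vanishes, and
-- λ(p/q) = λ(pq)/λ(q²) or λ(pq)/(2λ(q²)) according as q²λ(pq) ≤ pqλ(q²) (when pq > 0; else 0).
-- Atoms over fractions are then division-free: p/q = p′/q′ iff pq′ = p′q; the order is compared
-- after multiplying by (qq′)²; p/q ∈ A iff pq > 0 and q²λ(pq) = pqλ(q²); and D_{k+1}(p/q) iff
-- moreover D_{k+1}(λ(q²)^k λ(pq)). Each symbol of t at most quadruples the number of cases
-- and adds a bounded number of levels to the terms, so a term of length l gives 2^{O(l)} cases
-- of size 2^{O(l)}, and the disjunction over the cases has length 2^{O(l)}.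

module Submission where

open import Defs
open import Data.Nat using (ℕ; zero; suc; _+_; _*_; _^_; _≤_; _<_; z≤n; s≤s)
open import Data.Nat.Properties
open import Data.Fin using (Fin; zero; suc)
open import Data.List using (List; []; _∷_; map)
open import Data.List.Relation.Unary.Any using (here; there)
open import Data.List.Relation.Binary.Subset.Propositional using (_⊆_)
open import Data.List.Relation.Binary.Subset.Propositional.Properties using (∷⁺ʳ; map⁺; xs⊆x∷xs)
open import Data.Product using (Σ; _×_; _,_; proj₁; proj₂)
open import Function using (_∘_; id)
open import Data.Nat.Solver using (module +-*-Solver)
open import Relation.Binary.PropositionalEquality
  using (_≡_; refl; sym; trans; cong; cong₂; subst)

private variable
  n m l : ℕ

exts-cong : {σ τ : Fin n → Tm m} → (∀ i → σ i ≡ τ i) → ∀ i → exts σ i ≡ exts τ i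
exts-cong eq zero    = refl
exts-cong eq (suc i) = cong (renT suc) (eq i)

subT-cong : {σ τ : Fin n → Tm m} → (∀ i → σ i ≡ τ i) → ∀ t → subT σ t ≡ subT τ t
subT-cong eq (var i) = eq i
subT-cong eq c0      = refl
subT-cong eq c1      = refl
subT-cong eq (s ⊕ t) = cong₂ _⊕_ (subT-cong eq s) (subT-cong eq t)
subT-cong eq (s ⊖ t) = cong₂ _⊖_ (subT-cong eq s) (subT-cong eq t)
subT-cong eq (s ⊗ t) = cong₂ _⊗_ (subT-cong eq s) (subT-cong eq t)
subT-cong eq (lam t) = cong lam (subT-cong eq t)
subT-cong eq (s ⊘ t) = cong₂ _⊘_ (subT-cong eq s) (subT-cong eq t)

subF-cong : {σ τ : Fin n → Tm m} → (∀ i → σ i ≡ τ i) → ∀ φ → subF σ φ ≡ subF τ φ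
subF-cong eq ⊤'       = refl
subF-cong eq ⊥'       = refl
subF-cong eq (s ≐ t)  = cong₂ _≐_ (subT-cong eq s) (subT-cong eq t)
subF-cong eq (s ≺ t)  = cong₂ _≺_ (subT-cong eq s) (subT-cong eq t)
subF-cong eq (Ap t)   = cong Ap (subT-cong eq t)
subF-cong eq (Dp k t) = cong (Dp k) (subT-cong eq t)
subF-cong eq (¬' φ)   = cong ¬'_ (subF-cong eq φ)
subF-cong eq (φ ∧' ψ) = cong₂ _∧'_ (subF-cong eq φ) (subF-cong eq ψ)
subF-cong eq (φ ∨' ψ) = cong₂ _∨'_ (subF-cong eq φ) (subF-cong eq ψ)
subF-cong eq (φ ⟶ ψ)  = cong₂ _⟶_ (subF-cong eq φ) (subF-cong eq ψ)
subF-cong eq (φ ⟺ ψ)  = cong₂ _⟺_ (subF-cong eq φ) (subF-cong eq ψ)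
subF-cong eq (all φ)  = cong all (subF-cong (exts-cong eq) φ)
subF-cong eq (ex φ)   = cong ex (subF-cong (exts-cong eq) φ)

subT-renT : (σ : Fin m → Tm l) (ρ : Fin n → Fin m) → ∀ t → subT σ (renT ρ t) ≡ subT (σ ∘ ρ) t
subT-renT σ ρ (var i) = refl
subT-renT σ ρ c0      = refl
subT-renT σ ρ c1      = refl
subT-renT σ ρ (s ⊕ t) = cong₂ _⊕_ (subT-renT σ ρ s) (subT-renT σ ρ t)
subT-renT σ ρ (s ⊖ t) = cong₂ _⊖_ (subT-renT σ ρ s) (subT-renT σ ρ t)
subT-renT σ ρ (s ⊗ t) = cong₂ _⊗_ (subT-renT σ ρ s) (subT-renT σ ρ t)
subT-renT σ ρ (lam t) = cong lam (subT-renT σ ρ t)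
subT-renT σ ρ (s ⊘ t) = cong₂ _⊘_ (subT-renT σ ρ s) (subT-renT σ ρ t)

exts-ext : (σ : Fin m → Tm l) (ρ : Fin n → Fin m) → ∀ i → exts σ (ext ρ i) ≡ exts (σ ∘ ρ) i
exts-ext σ ρ zero    = refl
exts-ext σ ρ (suc i) = refl

subF-renF : (σ : Fin m → Tm l) (ρ : Fin n → Fin m) → ∀ φ → subF σ (renF ρ φ) ≡ subF (σ ∘ ρ) φ
subF-renF σ ρ ⊤'       = refl
subF-renF σ ρ ⊥'       = refl
subF-renF σ ρ (s ≐ t)  = cong₂ _≐_ (subT-renT σ ρ s) (subT-renT σ ρ t)
subF-renF σ ρ (s ≺ t)  = cong₂ _≺_ (subT-renT σ ρ s) (subT-renT σ ρ t)
subF-renF σ ρ (Ap t)   = cong Ap (subT-renT σ ρ t)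
subF-renF σ ρ (Dp k t) = cong (Dp k) (subT-renT σ ρ t)
subF-renF σ ρ (¬' φ)   = cong ¬'_ (subF-renF σ ρ φ)
subF-renF σ ρ (φ ∧' ψ) = cong₂ _∧'_ (subF-renF σ ρ φ) (subF-renF σ ρ ψ)
subF-renF σ ρ (φ ∨' ψ) = cong₂ _∨'_ (subF-renF σ ρ φ) (subF-renF σ ρ ψ)
subF-renF σ ρ (φ ⟶ ψ)  = cong₂ _⟶_ (subF-renF σ ρ φ) (subF-renF σ ρ ψ)
subF-renF σ ρ (φ ⟺ ψ)  = cong₂ _⟺_ (subF-renF σ ρ φ) (subF-renF σ ρ ψ)
subF-renF σ ρ (all φ)  = cong all (trans (subF-renF (exts σ) (ext ρ) φ) (subF-cong (exts-ext σ ρ) φ))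
subF-renF σ ρ (ex φ)   = cong ex (trans (subF-renF (exts σ) (ext ρ) φ) (subF-cong (exts-ext σ ρ) φ))

renT-subT : (ρ : Fin m → Fin l) (σ : Fin n → Tm m) → ∀ t → renT ρ (subT σ t) ≡ subT (renT ρ ∘ σ) t
renT-subT ρ σ (var i) = refl
renT-subT ρ σ c0      = refl
renT-subT ρ σ c1      = refl
renT-subT ρ σ (s ⊕ t) = cong₂ _⊕_ (renT-subT ρ σ s) (renT-subT ρ σ t)
renT-subT ρ σ (s ⊖ t) = cong₂ _⊖_ (renT-subT ρ σ s) (renT-subT ρ σ t)
renT-subT ρ σ (s ⊗ t) = cong₂ _⊗_ (renT-subT ρ σ s) (renT-subT ρ σ t)
renT-subT ρ σ (lam t) = cong lam (renT-subT ρ σ t)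
renT-subT ρ σ (s ⊘ t) = cong₂ _⊘_ (renT-subT ρ σ s) (renT-subT ρ σ t)

subT-subT : (σ : Fin m → Tm l) (τ : Fin n → Tm m) → ∀ t → subT σ (subT τ t) ≡ subT (subT σ ∘ τ) t
subT-subT σ τ (var i) = refl
subT-subT σ τ c0      = refl
subT-subT σ τ c1      = refl
subT-subT σ τ (s ⊕ t) = cong₂ _⊕_ (subT-subT σ τ s) (subT-subT σ τ t)
subT-subT σ τ (s ⊖ t) = cong₂ _⊖_ (subT-subT σ τ s) (subT-subT σ τ t)
subT-subT σ τ (s ⊗ t) = cong₂ _⊗_ (subT-subT σ τ s) (subT-subT σ τ t)
subT-subT σ τ (lam t) = cong lam (subT-subT σ τ t)
subT-subT σ τ (s ⊘ t) = cong₂ _⊘_ (subT-subT σ τ s) (subT-subT σ τ t)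

exts-exts : (σ : Fin m → Tm l) (τ : Fin n → Tm m) → ∀ i → subT (exts σ) (exts τ i) ≡ exts (subT σ ∘ τ) i
exts-exts σ τ zero    = refl
exts-exts σ τ (suc i) = trans (subT-renT (exts σ) suc (τ i)) (sym (renT-subT suc σ (τ i)))

subF-subF : (σ : Fin m → Tm l) (τ : Fin n → Tm m) → ∀ φ → subF σ (subF τ φ) ≡ subF (subT σ ∘ τ) φ
subF-subF σ τ ⊤'       = refl
subF-subF σ τ ⊥'       = refl
subF-subF σ τ (s ≐ t)  = cong₂ _≐_ (subT-subT σ τ s) (subT-subT σ τ t)
subF-subF σ τ (s ≺ t)  = cong₂ _≺_ (subT-subT σ τ s) (subT-subT σ τ t)
subF-subF σ τ (Ap t)   = cong Ap (subT-subT σ τ t)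
subF-subF σ τ (Dp k t) = cong (Dp k) (subT-subT σ τ t)
subF-subF σ τ (¬' φ)   = cong ¬'_ (subF-subF σ τ φ)
subF-subF σ τ (φ ∧' ψ) = cong₂ _∧'_ (subF-subF σ τ φ) (subF-subF σ τ ψ)
subF-subF σ τ (φ ∨' ψ) = cong₂ _∨'_ (subF-subF σ τ φ) (subF-subF σ τ ψ)
subF-subF σ τ (φ ⟶ ψ)  = cong₂ _⟶_ (subF-subF σ τ φ) (subF-subF σ τ ψ)
subF-subF σ τ (φ ⟺ ψ)  = cong₂ _⟺_ (subF-subF σ τ φ) (subF-subF σ τ ψ)
subF-subF σ τ (all φ)  = cong all (trans (subF-subF (exts σ) (exts τ) φ) (subF-cong (exts-exts σ τ) φ))
subF-subF σ τ (ex φ)   = cong ex (trans (subF-subF (exts σ) (exts τ) φ) (subF-cong (exts-exts σ τ) φ))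

subT-var : ∀ (t : Tm n) → subT var t ≡ t
subT-var (var i) = refl
subT-var c0      = refl
subT-var c1      = refl
subT-var (s ⊕ t) = cong₂ _⊕_ (subT-var s) (subT-var t)
subT-var (s ⊖ t) = cong₂ _⊖_ (subT-var s) (subT-var t)
subT-var (s ⊗ t) = cong₂ _⊗_ (subT-var s) (subT-var t)
subT-var (lam t) = cong lam (subT-var t)
subT-var (s ⊘ t) = cong₂ _⊘_ (subT-var s) (subT-var t)

wkT : Tm n → Tm (suc n)
wkT = renT suc

IsShift : (Fin (suc n) → Tm n) → Set
IsShift σ = ∀ i → σ (suc i) ≡ var i

subT-wkT : {σ : Fin (suc n) → Tm n} → IsShift σ → ∀ t → subT σ (wkT t) ≡ t
subT-wkT {σ = σ} shift t = trans (subT-renT σ suc t) (trans (subT-cong shift t) (subT-var t))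

subT-wkT² : {σ τ : Fin (suc n) → Tm n} → IsShift σ → IsShift τ →
            ∀ t → subT (subT σ ∘ exts τ) (wkT (wkT t)) ≡ t
subT-wkT² {σ = σ} {τ} shiftσ shiftτ t =
  trans (subT-renT (subT σ ∘ exts τ) suc (wkT t))
        (trans (subT-cong (λ i → subT-wkT shiftσ (τ i)) (wkT t)) (subT-wkT shiftτ t))

subT-pow : (σ : Fin n → Tm m) → ∀ t k → subT σ (pow t k) ≡ pow (subT σ t) k
subT-pow σ t zero    = refl
subT-pow σ t (suc k) = cong (_⊗ subT σ t) (subT-pow σ t k)

renT-pow : (ρ : Fin n → Fin m) → ∀ t k → renT ρ (pow t k) ≡ pow (renT ρ t) k
renT-pow ρ t zero    = refl
renT-pow ρ t (suc k) = cong (_⊗ renT ρ t) (renT-pow ρ t k)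

private variable
  Γ Δ : List (Fm n)
  φ φ′ ψ ψ′ χ : Fm n

⊢-mono : Γ ⊆ Δ → Γ ⊢ φ → Δ ⊢ φ
⊢-mono Γ⊆Δ (hyp φ∈Γ)        = hyp (Γ⊆Δ φ∈Γ)
⊢-mono Γ⊆Δ (ax A)           = ax A
⊢-mono Γ⊆Δ ⊤I               = ⊤I
⊢-mono Γ⊆Δ (⊥E d)           = ⊥E (⊢-mono Γ⊆Δ d)
⊢-mono Γ⊆Δ (raa d)          = raa (⊢-mono (∷⁺ʳ _ Γ⊆Δ) d)
⊢-mono Γ⊆Δ (¬I d)           = ¬I (⊢-mono (∷⁺ʳ _ Γ⊆Δ) d)
⊢-mono Γ⊆Δ (¬E d e)         = ¬E (⊢-mono Γ⊆Δ d) (⊢-mono Γ⊆Δ e)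
⊢-mono Γ⊆Δ (∧I d e)         = ∧I (⊢-mono Γ⊆Δ d) (⊢-mono Γ⊆Δ e)
⊢-mono Γ⊆Δ (∧E₁ d)          = ∧E₁ (⊢-mono Γ⊆Δ d)
⊢-mono Γ⊆Δ (∧E₂ d)          = ∧E₂ (⊢-mono Γ⊆Δ d)
⊢-mono Γ⊆Δ (∨I₁ d)          = ∨I₁ (⊢-mono Γ⊆Δ d)
⊢-mono Γ⊆Δ (∨I₂ d)          = ∨I₂ (⊢-mono Γ⊆Δ d)
⊢-mono Γ⊆Δ (∨E d e f)       = ∨E (⊢-mono Γ⊆Δ d) (⊢-mono (∷⁺ʳ _ Γ⊆Δ) e) (⊢-mono (∷⁺ʳ _ Γ⊆Δ) f)
⊢-mono Γ⊆Δ (⟶I d)           = ⟶I (⊢-mono (∷⁺ʳ _ Γ⊆Δ) d)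
⊢-mono Γ⊆Δ (⟶E d e)         = ⟶E (⊢-mono Γ⊆Δ d) (⊢-mono Γ⊆Δ e)
⊢-mono Γ⊆Δ (⟺I d e)         = ⟺I (⊢-mono (∷⁺ʳ _ Γ⊆Δ) d) (⊢-mono (∷⁺ʳ _ Γ⊆Δ) e)
⊢-mono Γ⊆Δ (⟺E₁ d e)        = ⟺E₁ (⊢-mono Γ⊆Δ d) (⊢-mono Γ⊆Δ e)
⊢-mono Γ⊆Δ (⟺E₂ d e)        = ⟺E₂ (⊢-mono Γ⊆Δ d) (⊢-mono Γ⊆Δ e)
⊢-mono Γ⊆Δ (allI d)         = allI (⊢-mono (map⁺ wkF Γ⊆Δ) d)
⊢-mono Γ⊆Δ (allE d t)       = allE (⊢-mono Γ⊆Δ d) t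
⊢-mono Γ⊆Δ (exI t d)        = exI t (⊢-mono Γ⊆Δ d)
⊢-mono Γ⊆Δ (exE d e)        = exE (⊢-mono Γ⊆Δ d) (⊢-mono (∷⁺ʳ _ (map⁺ wkF Γ⊆Δ)) e)
⊢-mono Γ⊆Δ (refl= t)        = refl= t
⊢-mono Γ⊆Δ (subst= φ d e)   = subst= φ (⊢-mono Γ⊆Δ d) (⊢-mono Γ⊆Δ e)

wk : Γ ⊢ φ → (ψ ∷ Γ) ⊢ φ
wk = ⊢-mono (xs⊆x∷xs _ _)

hyp₀ : (φ ∷ Γ) ⊢ φ
hyp₀ = hyp (here refl)

excluded-middle : ∀ φ → Γ ⊢ φ ∨' ¬' φ
excluded-middle φ = raa (¬E hyp₀ (∨I₂ (¬I (¬E (wk hyp₀) (∨I₁ hyp₀)))))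

by-cases : ∀ φ → (φ ∷ Γ) ⊢ χ → (¬' φ ∷ Γ) ⊢ χ → Γ ⊢ χ
by-cases φ = ∨E (excluded-middle φ)

contradiction : Γ ⊢ φ → Γ ⊢ ¬' φ → Γ ⊢ ψ
contradiction d e = ⊥E (¬E e d)

cut : Γ ⊢ φ → (φ ∷ Γ) ⊢ ψ → Γ ⊢ ψ
cut d e = ⟶E (⟶I e) d

-- The body of exE is checked in map wkF Γ; rather than renaming derivations along wkF, the
-- facts χ needed there are carried across the binder as an implication.
ex-elim-with : Γ ⊢ ex φ → Γ ⊢ χ → (wkF χ ∷ φ ∷ map wkF Γ) ⊢ wkF ψ → Γ ⊢ ψ
ex-elim-with d c e = ⟶E (exE d (⟶I e)) c

axiom₁ : {φ : Fm 1} → Ax (all φ) → (a : Tm n) → Γ ⊢ subF (λ _ → a) φ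
axiom₁ {Γ = Γ} {φ = φ} A a =
  subst (Γ ⊢_) (trans (subF-renF _ _ φ) (subF-cong (λ { zero → refl }) φ)) (allE (ax A) a)

axiom₂ : {φ : Fm 2} → Ax (all (all φ)) → (a b : Tm n) →
         Γ ⊢ subF (λ { zero → b ; (suc _) → a }) φ
axiom₂ {Γ = Γ} {φ = φ} A a b =
  subst (Γ ⊢_)
    (trans (subF-subF _ _ _) (trans (subF-renF _ _ φ)
      (subF-cong (λ { zero → refl ; (suc zero) → subT-wkT (λ _ → refl) a }) φ)))
    (allE (allE (ax A) a) b)

axiom₃ : {φ : Fm 3} → Ax (all (all (all φ))) → (a b c : Tm n) →
         Γ ⊢ subF (λ { zero → c ; (suc zero) → b ; (suc (suc _)) → a }) φ
axiom₃ {Γ = Γ} {φ = φ} A a b c =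
  subst (Γ ⊢_)
    (trans (subF-subF _ _ _) (trans (subF-subF _ _ _) (trans (subF-renF _ _ φ)
      (subF-cong (λ { zero → refl
                    ; (suc zero) → subT-wkT (λ _ → refl) b
                    ; (suc (suc zero)) → subT-wkT² (λ _ → refl) (λ _ → refl) a }) φ))))
    (allE (allE (allE (ax A) a) b) c)

private variable
  s t u v a b c : Tm n

≐-refl : Γ ⊢ t ≐ t
≐-refl {t = t} = refl= t

replace : ∀ (φ : Fm (suc n)) → Γ ⊢ s ≐ t → ψ ≡ φ [ s ] → φ [ t ] ≡ χ → Γ ⊢ ψ → Γ ⊢ χ
replace φ s≐t refl refl = subst= φ s≐t

≐-sym : Γ ⊢ s ≐ t → Γ ⊢ t ≐ s
≐-sym {s = s} s≐t =
  replace (x₀ ≐ wkT s) s≐t (cong (s ≐_) (sym (subT-wkT (λ _ → refl) s)))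
          (cong (_ ≐_) (subT-wkT (λ _ → refl) s)) ≐-refl

≐-trans : Γ ⊢ s ≐ t → Γ ⊢ t ≐ u → Γ ⊢ s ≐ u
≐-trans {s = s} s≐t t≐u =
  replace (wkT s ≐ x₀) t≐u (cong (_≐ _) (sym (subT-wkT (λ _ → refl) s)))
          (cong (_≐ _) (subT-wkT (λ _ → refl) s)) s≐t

≐-cong₂ : (_∙_ : ∀ {m} → Tm m → Tm m → Tm m) →
          (∀ {m l} (σ : Fin m → Tm l) x y → subT σ (x ∙ y) ≡ subT σ x ∙ subT σ y) →
          Γ ⊢ s ≐ t → Γ ⊢ u ≐ v → Γ ⊢ s ∙ u ≐ t ∙ v
≐-cong₂ {Γ = Γ} {s = s} {t = t} {u = u} {v = v} _∙_ hom s≐t u≐v = ≐-trans left right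
  where
  back : ∀ {σ : Fin (suc _) → Tm _} → IsShift σ → ∀ w → w ≡ subT σ (wkT w)
  back shift w = sym (subT-wkT shift w)
  left : Γ ⊢ s ∙ u ≐ t ∙ u
  left = replace (wkT (s ∙ u) ≐ x₀ ∙ wkT u) s≐t
    (cong₂ _≐_ (back (λ _ → refl) (s ∙ u)) (trans (cong (s ∙_) (back (λ _ → refl) u)) (sym (hom _ _ _))))
    (cong₂ _≐_ (subT-wkT (λ _ → refl) (s ∙ u)) (trans (hom _ _ _) (cong (t ∙_) (subT-wkT (λ _ → refl) u))))
    ≐-refl
  right : Γ ⊢ t ∙ u ≐ t ∙ v
  right = replace (wkT (t ∙ u) ≐ wkT t ∙ x₀) u≐v
    (cong₂ _≐_ (back (λ _ → refl) (t ∙ u)) (trans (cong (_∙ u) (back (λ _ → refl) t)) (sym (hom _ _ _))))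
    (cong₂ _≐_ (subT-wkT (λ _ → refl) (t ∙ u)) (trans (hom _ _ _) (cong (_∙ v) (subT-wkT (λ _ → refl) t))))
    ≐-refl

⊕-cong : Γ ⊢ s ≐ t → Γ ⊢ u ≐ v → Γ ⊢ s ⊕ u ≐ t ⊕ v
⊕-cong = ≐-cong₂ _⊕_ (λ _ _ _ → refl)

⊖-cong : Γ ⊢ s ≐ t → Γ ⊢ u ≐ v → Γ ⊢ s ⊖ u ≐ t ⊖ v
⊖-cong = ≐-cong₂ _⊖_ (λ _ _ _ → refl)

⊗-cong : Γ ⊢ s ≐ t → Γ ⊢ u ≐ v → Γ ⊢ s ⊗ u ≐ t ⊗ v
⊗-cong = ≐-cong₂ _⊗_ (λ _ _ _ → refl)

lam-cong : Γ ⊢ s ≐ t → Γ ⊢ lam s ≐ lam t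
lam-cong {s = s} {t = t} s≐t = replace (wkT (lam s) ≐ lam x₀) s≐t
  (cong (_≐ lam s) (sym (subT-wkT (λ _ → refl) (lam s)))) (cong (_≐ lam t) (subT-wkT (λ _ → refl) (lam s))) ≐-refl

≺-respˡ : Γ ⊢ s ≐ t → Γ ⊢ s ≺ u → Γ ⊢ t ≺ u
≺-respˡ {u = u} s≐t = replace (x₀ ≺ wkT u) s≐t
  (cong (_ ≺_) (sym (subT-wkT (λ _ → refl) u))) (cong (_ ≺_) (subT-wkT (λ _ → refl) u))

≺-respʳ : Γ ⊢ s ≐ t → Γ ⊢ u ≺ s → Γ ⊢ u ≺ t
≺-respʳ {u = u} s≐t = replace (wkT u ≺ x₀) s≐t
  (cong (_≺ _) (sym (subT-wkT (λ _ → refl) u))) (cong (_≺ _) (subT-wkT (λ _ → refl) u))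

≺-resp : Γ ⊢ s ≐ t → Γ ⊢ u ≐ v → Γ ⊢ s ≺ u → Γ ⊢ t ≺ v
≺-resp s≐t u≐v = ≺-respʳ u≐v ∘ ≺-respˡ s≐t

≼-resp : Γ ⊢ s ≐ t → Γ ⊢ u ≐ v → Γ ⊢ s ≼ u → Γ ⊢ t ≼ v
≼-resp s≐t u≐v s≼u = ∨E s≼u (∨I₁ (≺-resp (wk s≐t) (wk u≐v) hyp₀))
  (∨I₂ (≐-trans (≐-sym (wk s≐t)) (≐-trans hyp₀ (wk u≐v))))

Ap-resp : Γ ⊢ s ≐ t → Γ ⊢ Ap s → Γ ⊢ Ap t
Ap-resp s≐t = replace (Ap x₀) s≐t refl refl

Dp-resp : ∀ {k} → Γ ⊢ s ≐ t → Γ ⊢ Dp k s → Γ ⊢ Dp k t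
Dp-resp {k = k} s≐t = replace (Dp k x₀) s≐t refl refl

⊕-assoc : ∀ (a b c : Tm n) → Γ ⊢ (a ⊕ b) ⊕ c ≐ a ⊕ (b ⊕ c)
⊕-assoc = axiom₃ add-assoc

⊕-comm : ∀ (a b : Tm n) → Γ ⊢ a ⊕ b ≐ b ⊕ a
⊕-comm = axiom₂ add-comm

⊕-identityʳ : ∀ (a : Tm n) → Γ ⊢ a ⊕ c0 ≐ a
⊕-identityʳ = axiom₁ add-zero

⊖-⊕-cancel : ∀ (a b : Tm n) → Γ ⊢ (a ⊖ b) ⊕ b ≐ a
⊖-⊕-cancel = axiom₂ sub-def

⊗-assoc : ∀ (a b c : Tm n) → Γ ⊢ (a ⊗ b) ⊗ c ≐ a ⊗ (b ⊗ c)
⊗-assoc = axiom₃ mul-assoc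

⊗-comm : ∀ (a b : Tm n) → Γ ⊢ a ⊗ b ≐ b ⊗ a
⊗-comm = axiom₂ mul-comm

⊗-identityʳ : ∀ (a : Tm n) → Γ ⊢ a ⊗ c1 ≐ a
⊗-identityʳ = axiom₁ mul-one

⊗-distribˡ-⊕ : ∀ (a b c : Tm n) → Γ ⊢ a ⊗ (b ⊕ c) ≐ (a ⊗ b) ⊕ (a ⊗ c)
⊗-distribˡ-⊕ = axiom₃ distrib

⊕-cancelʳ : Γ ⊢ a ⊕ c ≐ b ⊕ c → Γ ⊢ a ≐ b
⊕-cancelʳ {Γ = Γ} {a = a} {c = c} {b = b} a+c≐b+c =
  ≐-trans (≐-sym (⊕-identityʳ a)) (≐-trans (⊕-cong ≐-refl (≐-sym c-c))
  (≐-trans (≐-sym (⊕-assoc a c (c0 ⊖ c))) (≐-trans (⊕-cong a+c≐b+c ≐-refl)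
  (≐-trans (⊕-assoc b c (c0 ⊖ c)) (≐-trans (⊕-cong ≐-refl c-c) (⊕-identityʳ b))))))
  where
  c-c : Γ ⊢ c ⊕ (c0 ⊖ c) ≐ c0
  c-c = ≐-trans (⊕-comm c (c0 ⊖ c)) (⊖-⊕-cancel c0 c)

⊗-zeroʳ : ∀ (a : Tm n) → Γ ⊢ a ⊗ c0 ≐ c0
⊗-zeroʳ a = ⊕-cancelʳ (≐-trans (≐-sym (⊗-distribˡ-⊕ a c0 c0))
  (≐-trans (⊗-cong ≐-refl (⊕-identityʳ c0)) (≐-sym (≐-trans (⊕-comm c0 (a ⊗ c0)) (⊕-identityʳ (a ⊗ c0))))))

module TermSemiring {n} (Γ : List (Fm n)) where
  open import Algebra.Bundles using (CommutativeSemiring)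
  open import Algebra.Structures using (IsSemigroup)
  open import Algebra.Structures.Biased using (IsCommutativeMonoidʳ; IsCommutativeSemiringʳ)

  _≈_ : Tm n → Tm n → Set
  x ≈ y = Γ ⊢ x ≐ y

  semigroup : ∀ {_∙_} → (∀ {x y u v} → x ≈ y → u ≈ v → (x ∙ u) ≈ (y ∙ v)) →
              (∀ x y z → ((x ∙ y) ∙ z) ≈ (x ∙ (y ∙ z))) → IsSemigroup _≈_ _∙_
  semigroup ∙-cong assoc = record
    { isMagma = record
      { isEquivalence = record { refl = ≐-refl ; sym = ≐-sym ; trans = ≐-trans }
      ; ∙-cong = ∙-cong }
    ; assoc = assoc }

  commutativeSemiring : CommutativeSemiring _ _
  commutativeSemiring = record
    { Carrier = Tm n ; _≈_ = _≈_ ; _+_ = _⊕_ ; _*_ = _⊗_ ; 0# = c0 ; 1# = c1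
    ; isCommutativeSemiring = IsCommutativeSemiringʳ.isCommutativeSemiring (record
      { +-isCommutativeMonoid = IsCommutativeMonoidʳ.isCommutativeMonoid (record
        { isSemigroup = semigroup ⊕-cong ⊕-assoc ; identityʳ = ⊕-identityʳ ; comm = ⊕-comm })
      ; *-isCommutativeMonoid = IsCommutativeMonoidʳ.isCommutativeMonoid (record
        { isSemigroup = semigroup ⊗-cong ⊗-assoc ; identityʳ = ⊗-identityʳ ; comm = ⊗-comm })
      ; distribˡ = ⊗-distribˡ-⊕
      ; zeroʳ = ⊗-zeroʳ }) }

  open import Algebra.Solver.Ring.NaturalCoefficients.Default commutativeSemiring public
    using (solve; _:+_; _:*_; _:=_; con)

  open import Relation.Binary.Reasoning.Setoid (CommutativeSemiring.setoid commutativeSemiring) public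

1≉0 : Γ ⊢ ¬' (c1 ≐ c0)
1≉0 = ¬I (¬E (ax zero≠one) (≐-sym hyp₀))

⊘-def : ∀ (s u : Tm n) → Γ ⊢ (s ⊘ u ≐ s ⊘ u) ⟺
          (((¬' (u ≐ c0)) ∧' (s ≐ u ⊗ (s ⊘ u))) ∨' ((u ≐ c0) ∧' (s ⊘ u ≐ c0)))
⊘-def s u = axiom₃ div-def s u (s ⊘ u)

⊗-⊘-cancel : Γ ⊢ ¬' (u ≐ c0) → Γ ⊢ u ⊗ (s ⊘ u) ≐ s
⊗-⊘-cancel {u = u} {s = s} u≉0 =
  ∨E (⟺E₁ (⊘-def s u) ≐-refl) (≐-sym (∧E₂ hyp₀)) (contradiction (∧E₁ hyp₀) (wk u≉0))

⊘-zero : Γ ⊢ u ≐ c0 → Γ ⊢ s ⊘ u ≐ c0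
⊘-zero {u = u} {s = s} u≐0 =
  ∨E (⟺E₁ (⊘-def s u) ≐-refl) (contradiction (wk u≐0) (∧E₁ hyp₀)) (∧E₂ hyp₀)

⊗-cancelˡ : Γ ⊢ ¬' (a ≐ c0) → Γ ⊢ a ⊗ s ≐ a ⊗ t → Γ ⊢ s ≐ t
⊗-cancelˡ {Γ = Γ} {a = a} {s = s} {t = t} a≉0 as≐at = begin
  s                  ≈⟨ unscale s ⟩
  (a ⊗ s) ⊗ (c1 ⊘ a) ≈⟨ ⊗-cong as≐at ≐-refl ⟩
  (a ⊗ t) ⊗ (c1 ⊘ a) ≈⟨ ≐-sym (unscale t) ⟩
  t                  ∎
  where
  open TermSemiring Γ
  unscale : ∀ x → Γ ⊢ x ≐ (a ⊗ x) ⊗ (c1 ⊘ a)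
  unscale x = begin
    x                  ≈⟨ ≐-sym (⊗-identityʳ x) ⟩
    x ⊗ c1             ≈⟨ ⊗-cong ≐-refl (≐-sym (⊗-⊘-cancel a≉0)) ⟩
    x ⊗ (a ⊗ (c1 ⊘ a)) ≈⟨ solve 3 (λ x a i → x :* (a :* i) := (a :* x) :* i) ≐-refl x a (c1 ⊘ a) ⟩
    (a ⊗ x) ⊗ (c1 ⊘ a) ∎

⊗-≉0 : Γ ⊢ ¬' (a ≐ c0) → Γ ⊢ ¬' (b ≐ c0) → Γ ⊢ ¬' (a ⊗ b ≐ c0)
⊗-≉0 {a = a} a≉0 b≉0 =
  ¬I (¬E (wk b≉0) (⊗-cancelˡ (wk a≉0) (≐-trans hyp₀ (≐-sym (⊗-zeroʳ a)))))

⊖-unique : Γ ⊢ s ⊕ u ≐ t → Γ ⊢ s ≐ t ⊖ u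
⊖-unique {u = u} {t = t} s+u≐t = ⊕-cancelʳ (≐-trans s+u≐t (≐-sym (⊖-⊕-cancel t u)))

⊗-distribˡ-⊖ : ∀ (a b c : Tm n) → Γ ⊢ a ⊗ (b ⊖ c) ≐ (a ⊗ b) ⊖ (a ⊗ c)
⊗-distribˡ-⊖ a b c =
  ⊖-unique (≐-trans (≐-sym (⊗-distribˡ-⊕ a (b ⊖ c) c)) (⊗-cong ≐-refl (⊖-⊕-cancel b c)))

square-of-opposite : Γ ⊢ a ⊕ b ≐ c0 → Γ ⊢ a ⊗ a ≐ b ⊗ b
square-of-opposite {Γ = Γ} {a = a} {b = b} a+b≐0 = ⊕-cancelʳ (begin
  a ⊗ a ⊕ a ⊗ b ≈⟨ solve 2 (λ a b → a :* a :+ a :* b := a :* (a :+ b)) ≐-refl a b ⟩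
  a ⊗ (a ⊕ b)   ≈⟨ ⊗-cong ≐-refl a+b≐0 ⟩
  a ⊗ c0        ≈⟨ ⊗-zeroʳ a ⟩
  c0            ≈⟨ ≐-sym (⊗-zeroʳ b) ⟩
  b ⊗ c0        ≈⟨ ⊗-cong ≐-refl (≐-sym a+b≐0) ⟩
  b ⊗ (a ⊕ b)   ≈⟨ solve 2 (λ a b → b :* (a :+ b) := b :* b :+ a :* b) ≐-refl a b ⟩
  b ⊗ b ⊕ a ⊗ b ∎)
  where open TermSemiring Γ

≺-irrefl : Γ ⊢ a ≺ a → Γ ⊢ φ
≺-irrefl {a = a} a<a = contradiction a<a (axiom₁ lt-irrefl a)

≺-trans : Γ ⊢ a ≺ b → Γ ⊢ b ≺ c → Γ ⊢ a ≺ c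
≺-trans {a = a} {b = b} {c = c} a<b b<c = ⟶E (axiom₃ lt-trans a b c) (∧I a<b b<c)

trichotomy : ∀ (a b : Tm n) → ((a ≺ b) ∷ Γ) ⊢ χ → ((a ≐ b) ∷ Γ) ⊢ χ → ((b ≺ a) ∷ Γ) ⊢ χ → Γ ⊢ χ
trichotomy a b lt eq gt =
  ∨E (axiom₂ lt-total a b) lt (∨E hyp₀ (⊢-mono (∷⁺ʳ _ there) eq) (⊢-mono (∷⁺ʳ _ there) gt))

≺-≉ : Γ ⊢ a ≺ b → Γ ⊢ ¬' (b ≐ a)
≺-≉ a<b = ¬I (≺-irrefl (≺-respʳ hyp₀ (wk a<b)))

≼-≺-trans : Γ ⊢ a ≼ b → Γ ⊢ b ≺ c → Γ ⊢ a ≺ c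
≼-≺-trans a≼b b<c = ∨E a≼b (≺-trans hyp₀ (wk b<c)) (≺-respˡ (≐-sym hyp₀) (wk b<c))

≺-≼-trans : Γ ⊢ a ≺ b → Γ ⊢ b ≼ c → Γ ⊢ a ≺ c
≺-≼-trans a<b b≼c = ∨E b≼c (≺-trans (wk a<b) hyp₀) (≺-respʳ hyp₀ (wk a<b))

≮⇒≽ : ∀ (a b : Tm n) → Γ ⊢ ¬' (a ≺ b) → Γ ⊢ b ≼ a
≮⇒≽ a b a≮b = trichotomy a b (contradiction hyp₀ (wk a≮b)) (∨I₂ (≐-sym hyp₀)) (∨I₁ hyp₀)

⋠⇒≻ : ∀ (a b : Tm n) → Γ ⊢ ¬' (a ≼ b) → Γ ⊢ b ≺ a
⋠⇒≻ a b a⋠b = trichotomy a b (contradiction (∨I₁ hyp₀) (wk a⋠b)) (contradiction (∨I₂ hyp₀) (wk a⋠b)) hyp₀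

⊕-monoˡ-≺ : Γ ⊢ a ≺ b → Γ ⊢ a ⊕ c ≺ b ⊕ c
⊕-monoˡ-≺ {a = a} {b = b} {c = c} = ⟶E (axiom₃ lt-add a b c)

0≺⊗ : Γ ⊢ c0 ≺ a → Γ ⊢ c0 ≺ b → Γ ⊢ c0 ≺ a ⊗ b
0≺⊗ {a = a} {b = b} 0<a 0<b = ⟶E (axiom₂ lt-mul a b) (∧I 0<a 0<b)

≺⇒0≺⊖ : Γ ⊢ a ≺ b → Γ ⊢ c0 ≺ b ⊖ a
≺⇒0≺⊖ {Γ = Γ} {a = a} {b = b} a<b =
  ≺-resp (≐-trans (⊕-comm a (c0 ⊖ a)) (⊖-⊕-cancel c0 a)) (≐-sym b-a) (⊕-monoˡ-≺ a<b)
  where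
  b-a : Γ ⊢ b ⊖ a ≐ b ⊕ (c0 ⊖ a)
  b-a = ≐-sym (⊖-unique (≐-trans (⊕-assoc b (c0 ⊖ a) a)
                        (≐-trans (⊕-cong ≐-refl (⊖-⊕-cancel c0 a)) (⊕-identityʳ b))))

0≺⊖⇒≺ : Γ ⊢ c0 ≺ b ⊖ a → Γ ⊢ a ≺ b
0≺⊖⇒≺ {b = b} {a = a} 0<b-a =
  ≺-resp (≐-trans (⊕-comm c0 a) (⊕-identityʳ a)) (⊖-⊕-cancel b a) (⊕-monoˡ-≺ 0<b-a)

⊗-monoʳ-≺ : Γ ⊢ c0 ≺ c → Γ ⊢ a ≺ b → Γ ⊢ c ⊗ a ≺ c ⊗ b
⊗-monoʳ-≺ {c = c} {a = a} {b = b} 0<c a<b =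
  0≺⊖⇒≺ (≺-respʳ (⊗-distribˡ-⊖ c b a) (0≺⊗ 0<c (≺⇒0≺⊖ a<b)))

⊗-monoʳ-≼ : Γ ⊢ c0 ≺ c → Γ ⊢ a ≼ b → Γ ⊢ (c ⊗ a) ≼ (c ⊗ b)
⊗-monoʳ-≼ 0<c a≼b = ∨E a≼b (∨I₁ (⊗-monoʳ-≺ (wk 0<c) hyp₀)) (∨I₂ (⊗-cong ≐-refl hyp₀))

⊗-cancelˡ-≺ : Γ ⊢ c0 ≺ c → Γ ⊢ c ⊗ a ≺ c ⊗ b → Γ ⊢ a ≺ b
⊗-cancelˡ-≺ {a = a} {b = b} 0<c ca<cb = trichotomy a b hyp₀
  (≺-irrefl (≺-respʳ (⊗-cong ≐-refl (≐-sym hyp₀)) (wk ca<cb)))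
  (≺-irrefl (≺-trans (wk ca<cb) (⊗-monoʳ-≺ (wk 0<c) hyp₀)))

⊗-cancelˡ-≼ : Γ ⊢ c0 ≺ c → Γ ⊢ (c ⊗ a) ≼ (c ⊗ b) → Γ ⊢ a ≼ b
⊗-cancelˡ-≼ {a = a} {b = b} 0<c ca≼cb =
  ≮⇒≽ b a (¬I (≺-irrefl (≼-≺-trans (wk ca≼cb) (⊗-monoʳ-≺ (wk 0<c) hyp₀))))

0≺square : ∀ (a : Tm n) → Γ ⊢ ¬' (a ≐ c0) → Γ ⊢ c0 ≺ a ⊗ a
0≺square a a≉0 = trichotomy a c0
  (≺-respʳ (square-of-opposite (⊖-⊕-cancel c0 a)) (0≺⊗ (≺⇒0≺⊖ hyp₀) (≺⇒0≺⊖ hyp₀)))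
  (contradiction hyp₀ (wk a≉0))
  (0≺⊗ hyp₀ hyp₀)

0≺1 : Γ ⊢ c0 ≺ c1
0≺1 = ≺-respʳ (⊗-identityʳ c1) (0≺square c1 1≉0)

0≺2 : Γ ⊢ c0 ≺ two
0≺2 = ≺-trans 0≺1 (≺-respˡ (≐-trans (⊕-comm c0 c1) (⊕-identityʳ c1)) (⊕-monoˡ-≺ 0≺1))

Ap-pos : Γ ⊢ Ap a → Γ ⊢ c0 ≺ a
Ap-pos {a = a} = ⟶E (axiom₁ A-pos a)

Ap-≉0 : Γ ⊢ Ap a → Γ ⊢ ¬' (a ≐ c0)
Ap-≉0 Aa = ≺-≉ (Ap-pos Aa)

Ap-⊗ : Γ ⊢ Ap a → Γ ⊢ Ap b → Γ ⊢ Ap (a ⊗ b)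
Ap-⊗ {a = a} {b = b} Aa = ⟺E₁ (⟶E (axiom₂ A-mul a b) Aa)

Ap-⊗⁻ : Γ ⊢ Ap a → Γ ⊢ Ap (a ⊗ b) → Γ ⊢ Ap b
Ap-⊗⁻ {a = a} {b = b} Aa = ⟺E₂ (⟶E (axiom₂ A-mul a b) Aa)

Ap-⊘ : Γ ⊢ Ap a → Γ ⊢ Ap b → Γ ⊢ Ap (a ⊘ b)
Ap-⊘ Aa Ab = Ap-⊗⁻ Ab (Ap-resp (≐-sym (⊗-⊘-cancel (Ap-≉0 Ab))) Aa)

Ap-two : Γ ⊢ Ap two
Ap-two = ∧E₁ (ax A-two)

Ap-one : Γ ⊢ Ap c1
Ap-one = Ap-⊗⁻ Ap-two (Ap-resp (≐-sym (⊗-identityʳ two)) Ap-two)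

Ap-gap : Γ ⊢ c1 ≺ a → Γ ⊢ a ≺ two → Γ ⊢ ¬' Ap a
Ap-gap {a = a} 1<a a<2 = ⟶E (allE (∧E₂ (ax A-two)) a) (∧I 1<a a<2)

-- c < d with d ≤ x < 2c would put d/c ∈ A strictly between 1 and 2.
Ap-unique : Γ ⊢ Ap c → Γ ⊢ c ≼ t → Γ ⊢ t ≺ two ⊗ c →
            Γ ⊢ Ap b → Γ ⊢ b ≼ t → Γ ⊢ t ≺ two ⊗ b → Γ ⊢ c ≐ b
Ap-unique {c = c} {b = b} Ac c≤t t<2c Ab b≤t t<2b = trichotomy c b
  (⊥E (gap (wk Ac) (wk Ab) (wk b≤t) (wk t<2c) hyp₀))
  hyp₀
  (⊥E (gap (wk Ab) (wk Ac) (wk c≤t) (wk t<2b) hyp₀))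
  where
  gap : ∀ {Δ : List (Fm _)} {c d} → Δ ⊢ Ap c → Δ ⊢ Ap d →
        Δ ⊢ d ≼ t → Δ ⊢ t ≺ two ⊗ c → Δ ⊢ c ≺ d → Δ ⊢ ⊥'
  gap {Δ = Δ} {c} {d} Ac Ad d≤t t<2c c<d = ¬E (Ap-gap 1<d/c d/c<2) (Ap-⊘ Ad Ac)
    where
    c[d/c] : Δ ⊢ c ⊗ (d ⊘ c) ≐ d
    c[d/c] = ⊗-⊘-cancel (Ap-≉0 Ac)
    1<d/c : Δ ⊢ c1 ≺ d ⊘ c
    1<d/c = ⊗-cancelˡ-≺ (Ap-pos Ac) (≺-resp (≐-sym (⊗-identityʳ c)) (≐-sym c[d/c]) c<d)
    d/c<2 : Δ ⊢ d ⊘ c ≺ two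
    d/c<2 = ⊗-cancelˡ-≺ (Ap-pos Ac) (≺-resp (≐-sym c[d/c]) (⊗-comm two c) (≼-≺-trans d≤t t<2c))

lam-spec : Γ ⊢ c0 ≺ t → Γ ⊢ Ap (lam t) ∧' ((lam t ≼ t) ∧' (t ≺ two ⊗ lam t))
lam-spec {t = t} = ⟶E (axiom₁ lam-pos t)

Ap-lam : Γ ⊢ c0 ≺ t → Γ ⊢ Ap (lam t)
Ap-lam 0<t = ∧E₁ (lam-spec 0<t)

lam-≼ : Γ ⊢ c0 ≺ t → Γ ⊢ lam t ≼ t
lam-≼ 0<t = ∧E₁ (∧E₂ (lam-spec 0<t))

≺-2lam : Γ ⊢ c0 ≺ t → Γ ⊢ t ≺ two ⊗ lam t
≺-2lam 0<t = ∧E₂ (∧E₂ (lam-spec 0<t))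

lam-char : Γ ⊢ Ap c → Γ ⊢ c ≼ t → Γ ⊢ t ≺ two ⊗ c → Γ ⊢ lam t ≐ c
lam-char {Γ = Γ} {t = t} Ac c≤t t<2c = Ap-unique (Ap-lam 0<t) (lam-≼ 0<t) (≺-2lam 0<t) Ac c≤t t<2c
  where
  0<t : Γ ⊢ c0 ≺ t
  0<t = ≺-≼-trans (Ap-pos Ac) c≤t

lam-of-nonpos : Γ ⊢ ¬' (c0 ≺ t) → Γ ⊢ lam t ≐ c0
lam-of-nonpos {t = t} t≯0 = ⟶E (axiom₁ lam-nonpos t) (≮⇒≽ c0 t t≯0)

lam-⊗-Ap : Γ ⊢ c0 ≺ t → Γ ⊢ Ap a → Γ ⊢ lam (t ⊗ a) ≐ lam t ⊗ a
lam-⊗-Ap {Γ = Γ} {t = t} {a = a} 0<t Aa =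
  lam-char (Ap-⊗ (Ap-lam 0<t) Aa)
    (≼-resp (⊗-comm a (lam t)) (⊗-comm a t) (⊗-monoʳ-≼ 0<a (lam-≼ 0<t)))
    (≺-resp (⊗-comm a t) (solve 2 (λ a l → a :* (con 2 :* l) := con 2 :* (l :* a)) ≐-refl a (lam t))
            (⊗-monoʳ-≺ 0<a (≺-2lam 0<t)))
  where
  open TermSemiring Γ
  0<a : Γ ⊢ c0 ≺ a
  0<a = Ap-pos Aa

lam-ratio : ∀ {P Q α γ : Tm n} → Γ ⊢ c0 ≺ Q → Γ ⊢ Q ⊗ s ≐ P → Γ ⊢ Ap α → Γ ⊢ Ap γ →
            Γ ⊢ (Q ⊗ α) ≼ (γ ⊗ P) → Γ ⊢ γ ⊗ P ≺ two ⊗ (Q ⊗ α) → Γ ⊢ lam s ≐ α ⊘ γ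
lam-ratio {Γ = Γ} {s = s} {P = P} {Q} {α} {γ} 0<Q Qs≐P Aα Aγ lower upper =
  lam-char (Ap-⊘ Aα Aγ)
    (⊗-cancelˡ-≼ 0<K (≼-resp (≐-sym Kc≐Qα) (≐-sym Ks≐γP) lower))
    (⊗-cancelˡ-≺ 0<K (≺-resp (≐-sym Ks≐γP) (≐-sym K2c≐2Qα) upper))
  where
  open TermSemiring Γ
  K : Tm _
  K = Q ⊗ γ
  0<K : Γ ⊢ c0 ≺ K
  0<K = 0≺⊗ 0<Q (Ap-pos Aγ)
  γc≐α : Γ ⊢ γ ⊗ (α ⊘ γ) ≐ α
  γc≐α = ⊗-⊘-cancel (Ap-≉0 Aγ)
  Kc≐Qα : Γ ⊢ K ⊗ (α ⊘ γ) ≐ Q ⊗ α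
  Kc≐Qα = ≐-trans (⊗-assoc Q γ (α ⊘ γ)) (⊗-cong ≐-refl γc≐α)
  K2c≐2Qα : Γ ⊢ K ⊗ (two ⊗ (α ⊘ γ)) ≐ two ⊗ (Q ⊗ α)
  K2c≐2Qα = ≐-trans (solve 3 (λ Q γ c → (Q :* γ) :* (con 2 :* c) := con 2 :* (Q :* (γ :* c))) ≐-refl Q γ (α ⊘ γ))
                   (⊗-cong ≐-refl (⊗-cong ≐-refl γc≐α))
  Ks≐γP : Γ ⊢ K ⊗ s ≐ γ ⊗ P
  Ks≐γP = ≐-trans (solve 3 (λ Q γ s → (Q :* γ) :* s := γ :* (Q :* s)) ≐-refl Q γ s) (⊗-cong ≐-refl Qs≐P)

lam-ratio-≼ : ∀ {P Q : Tm n} → Γ ⊢ c0 ≺ P → Γ ⊢ c0 ≺ Q → Γ ⊢ Q ⊗ s ≐ P →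
              Γ ⊢ (Q ⊗ lam P) ≼ (P ⊗ lam Q) → Γ ⊢ lam s ≐ lam P ⊘ lam Q
lam-ratio-≼ {Γ = Γ} {P = P} {Q} 0<P 0<Q Qs≐P below =
  lam-ratio 0<Q Qs≐P (Ap-lam 0<P) (Ap-lam 0<Q) (≼-resp ≐-refl (⊗-comm P (lam Q)) below) upper
  where
  open TermSemiring Γ
  upper : Γ ⊢ lam Q ⊗ P ≺ two ⊗ (Q ⊗ lam P)
  upper = ≺-≼-trans
    (⊗-monoʳ-≺ (Ap-pos (Ap-lam 0<Q)) (≺-2lam 0<P))
    (≼-resp (⊗-comm _ (lam Q)) (solve 2 (λ α Q → (con 2 :* α) :* Q := con 2 :* (Q :* α)) ≐-refl (lam P) Q)
            (⊗-monoʳ-≼ (0≺⊗ 0≺2 (Ap-pos (Ap-lam 0<P))) (lam-≼ 0<Q)))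

lam-ratio-≻ : ∀ {P Q : Tm n} → Γ ⊢ c0 ≺ P → Γ ⊢ c0 ≺ Q → Γ ⊢ Q ⊗ s ≐ P →
              Γ ⊢ ¬' ((Q ⊗ lam P) ≼ (P ⊗ lam Q)) → Γ ⊢ lam s ≐ lam P ⊘ (two ⊗ lam Q)
lam-ratio-≻ {Γ = Γ} {P = P} {Q} 0<P 0<Q Qs≐P above =
  lam-ratio 0<Q Qs≐P (Ap-lam 0<P) (Ap-⊗ Ap-two (Ap-lam 0<Q)) (∨I₁ lower) upper
  where
  open TermSemiring Γ
  lower : Γ ⊢ Q ⊗ lam P ≺ (two ⊗ lam Q) ⊗ P
  lower = ≼-≺-trans (⊗-monoʳ-≼ 0<Q (lam-≼ 0<P))
    (≺-resp (⊗-comm P Q) (⊗-comm P _) (⊗-monoʳ-≺ 0<P (≺-2lam 0<Q)))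
  upper : Γ ⊢ (two ⊗ lam Q) ⊗ P ≺ two ⊗ (Q ⊗ lam P)
  upper = ≺-respˡ (solve 2 (λ β P → con 2 :* (P :* β) := (con 2 :* β) :* P) ≐-refl (lam Q) P)
    (⊗-monoʳ-≺ 0≺2 (⋠⇒≻ (Q ⊗ lam P) (P ⊗ lam Q) above))

-- P/Q ∈ A for Q > 0, because x > 0 lies in A iff λ(Q x) = λ(Q) x.
RatioInA : Tm n → Tm n → Fm n
RatioInA P Q = (c0 ≺ P) ∧' (Q ⊗ lam P ≐ P ⊗ lam Q)

RatioInA⇒lam : ∀ {P Q : Tm n} → Γ ⊢ c0 ≺ Q → Γ ⊢ Q ⊗ s ≐ P → Γ ⊢ RatioInA P Q →
               Γ ⊢ lam Q ⊗ s ≐ lam P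
RatioInA⇒lam {Γ = Γ} {s = s} {P = P} {Q} 0<Q Qs≐P PQ∈A = ⊗-cancelˡ (≺-≉ 0<Q) (begin
  Q ⊗ (lam Q ⊗ s) ≈⟨ solve 3 (λ Q β s → Q :* (β :* s) := β :* (Q :* s)) ≐-refl Q (lam Q) s ⟩
  lam Q ⊗ (Q ⊗ s) ≈⟨ ⊗-cong ≐-refl Qs≐P ⟩
  lam Q ⊗ P       ≈⟨ ⊗-comm (lam Q) P ⟩
  P ⊗ lam Q       ≈⟨ ≐-sym (∧E₂ PQ∈A) ⟩
  Q ⊗ lam P       ∎)
  where open TermSemiring Γ

Ap-ratio : ∀ {P Q : Tm n} → Γ ⊢ c0 ≺ Q → Γ ⊢ Q ⊗ s ≐ P → Γ ⊢ Ap s ⟺ RatioInA P Q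
Ap-ratio {Γ = Γ} {s = s} {P = P} {Q} 0<Q Qs≐P = ⟺I
  (∧I 0<P (begin
     Q ⊗ lam P       ≈⟨ ⊗-cong ≐-refl λP≐λQs ⟩
     Q ⊗ (lam Q ⊗ s) ≈⟨ solve 3 (λ Q β s → Q :* (β :* s) := (Q :* s) :* β) ≐-refl Q (lam Q) s ⟩
     (Q ⊗ s) ⊗ lam Q ≈⟨ ⊗-cong (wk Qs≐P) ≐-refl ⟩
     P ⊗ lam Q       ∎))
  (Ap-⊗⁻ (Ap-lam (wk 0<Q))
     (Ap-resp (≐-sym (RatioInA⇒lam (wk 0<Q) (wk Qs≐P) hyp₀)) (Ap-lam (∧E₁ hyp₀))))
  where
  open TermSemiring (Ap s ∷ Γ)
  0<P : (Ap s ∷ Γ) ⊢ c0 ≺ P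
  0<P = ≺-respʳ (wk Qs≐P) (0≺⊗ (wk 0<Q) (Ap-pos hyp₀))
  λP≐λQs : (Ap s ∷ Γ) ⊢ lam P ≐ lam Q ⊗ s
  λP≐λQs = ≐-trans (≐-sym (lam-cong (wk Qs≐P))) (lam-⊗-Ap (wk 0<Q) hyp₀)

pow-cong : ∀ k → Γ ⊢ a ≐ b → Γ ⊢ pow a k ≐ pow b k
pow-cong zero    a≐b = ≐-refl
pow-cong (suc k) a≐b = ⊗-cong (pow-cong k a≐b) a≐b

pow-⊗ : ∀ k (a b : Tm n) → Γ ⊢ pow (a ⊗ b) k ≐ pow a k ⊗ pow b k
pow-⊗ zero    a b = ≐-sym (⊗-identityʳ c1)
pow-⊗ {Γ = Γ} (suc k) a b = ≐-trans (⊗-cong (pow-⊗ k a b) ≐-refl)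
  (solve 4 (λ A B a b → (A :* B) :* (a :* b) := (A :* a) :* (B :* b)) ≐-refl (pow a k) (pow b k) a b)
  where open TermSemiring Γ

Ap-pow : ∀ k → Γ ⊢ Ap a → Γ ⊢ Ap (pow a k)
Ap-pow zero    Aa = Ap-one
Ap-pow (suc k) Aa = Ap-⊗ (Ap-pow k Aa) Aa

IsRoot : ℕ → Tm n → Fm (suc n)
IsRoot k t = Ap x₀ ∧' (pow x₀ (suc k) ≐ wkT t)

Dp-def : ∀ k (t : Tm n) → Γ ⊢ Dp k t ⟺ ex (IsRoot k t)
Dp-def {Γ = Γ} k t =
  subst (Γ ⊢_) (cong (λ p → Dp k t ⟺ ex (Ap x₀ ∧' (p ≐ wkT t))) (subT-pow _ x₀ (suc k))) (axiom₁ (D-def k) t)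

Dp-intro : ∀ k → Γ ⊢ Ap a → Γ ⊢ pow a (suc k) ≐ t → Γ ⊢ Dp k t
Dp-intro {Γ = Γ} {a = a} {t = t} k Aa aᵏ⁺¹≐t = ⟺E₂ (Dp-def k t) (exI a (subst (Γ ⊢_)
  (cong₂ (λ p u → Ap a ∧' (p ≐ u)) (sym (subT-pow _ x₀ (suc k))) (sym (subT-wkT (λ _ → refl) t)))
  (∧I Aa aᵏ⁺¹≐t)))

Dp⇒Ap : ∀ k → Γ ⊢ Dp k t → Γ ⊢ Ap t
Dp⇒Ap k Dt = exE (⟺E₁ (Dp-def k _) Dt) (Ap-resp (∧E₂ hyp₀) (Ap-pow (suc k) (∧E₁ hyp₀)))

Dp-⊗-pow : ∀ k → Γ ⊢ Ap b → Γ ⊢ Dp k t → Γ ⊢ Dp k (pow b (suc k) ⊗ t)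
Dp-⊗-pow {b = b} {t = t} k Ab Dt =
  ex-elim-with (⟺E₁ (Dp-def k t) Dt) Ab (rename-pow (Dp-intro k
    (Ap-⊗ hyp₀ (∧E₁ (wk hyp₀)))
    (≐-trans (pow-⊗ (suc k) (wkT b) x₀) (⊗-cong ≐-refl (∧E₂ (wk hyp₀))))))
  where
  rename-pow : ∀ {Δ} → Δ ⊢ Dp k (pow (wkT b) (suc k) ⊗ wkT t) → Δ ⊢ wkF (Dp k (pow b (suc k) ⊗ t))
  rename-pow {Δ} = subst (Δ ⊢_) (cong (λ p → Dp k (p ⊗ wkT t)) (sym (renT-pow suc b (suc k))))

Dp-⊗-pow⁻ : ∀ k → Γ ⊢ Ap b → Γ ⊢ Dp k (pow b (suc k) ⊗ t) → Γ ⊢ Dp k t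
Dp-⊗-pow⁻ {b = b} {t = t} k Ab Dbt =
  ex-elim-with (⟺E₁ (Dp-def k _) Dbt) Ab (Dp-intro k
    (Ap-⊘ (∧E₁ (wk hyp₀)) hyp₀)
    (⊗-cancelˡ (Ap-≉0 (Ap-pow (suc k) hyp₀))
      (≐-trans (≐-sym (pow-⊗ (suc k) (wkT b) (x₀ ⊘ wkT b)))
      (≐-trans (pow-cong (suc k) (⊗-⊘-cancel (Ap-≉0 hyp₀)))
               (rename-pow (∧E₂ (wk hyp₀)))))))
  where
  rename-pow : ∀ {Δ u} → Δ ⊢ u ≐ wkT (pow b (suc k) ⊗ t) → Δ ⊢ u ≐ pow (wkT b) (suc k) ⊗ wkT t
  rename-pow {Δ} {u} = subst (Δ ⊢_) (cong (λ p → u ≐ p ⊗ wkT t) (renT-pow suc b (suc k)))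

-- With β = λ Q ∈ A we have β s = λ P, so β^{k+1} s = β^k λ P, and D_{k+1} is invariant under β^{k+1}.
Dp-ratio : ∀ k {P Q : Tm n} → Γ ⊢ c0 ≺ Q → Γ ⊢ Q ⊗ s ≐ P →
           Γ ⊢ Dp k s ⟺ (RatioInA P Q ∧' Dp k (pow (lam Q) k ⊗ lam P))
Dp-ratio {Γ = Γ} {s = s} k {P} {Q} 0<Q Qs≐P = ⟺I
  (∧I s∈A⇒ratio (Dp-resp (scaled s∈A⇒ratio) (Dp-⊗-pow k (Ap-lam (wk 0<Q)) hyp₀)))
  (Dp-⊗-pow⁻ k (Ap-lam (wk 0<Q)) (Dp-resp (≐-sym (scaled (∧E₁ hyp₀))) (∧E₂ hyp₀)))
  where
  scaled : ∀ {χ} → (χ ∷ Γ) ⊢ RatioInA P Q → (χ ∷ Γ) ⊢ pow (lam Q) (suc k) ⊗ s ≐ pow (lam Q) k ⊗ lam P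
  scaled ratio = ≐-trans (⊗-assoc _ _ s) (⊗-cong ≐-refl (RatioInA⇒lam (wk 0<Q) (wk Qs≐P) ratio))
  s∈A⇒ratio : (Dp k s ∷ Γ) ⊢ RatioInA P Q
  s∈A⇒ratio = ⟺E₁ (Ap-ratio (wk 0<Q) (wk Qs≐P)) (Dp⇒Ap k hyp₀)

data CaseTree (n : ℕ) (X : Set) : Set where
  leaf  : X → CaseTree n X
  split : Fm n → CaseTree n X → CaseTree n X → CaseTree n X

private variable
  X Y Z : Set

_>>=_ : CaseTree n X → (X → CaseTree n Y) → CaseTree n Y
leaf x      >>= f = f x
split c T U >>= f = split c (T >>= f) (U >>= f)

bind₂ : (X → Y → CaseTree n Z) → CaseTree n X → CaseTree n Y → CaseTree n Z
bind₂ f T U = T >>= λ x → U >>= λ y → f x y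

mapLeaves₂ : (X → Y → Z) → CaseTree n X → CaseTree n Y → CaseTree n Z
mapLeaves₂ f = bind₂ (λ x y → leaf (f x y))

mapLeaves : (X → Y) → CaseTree n X → CaseTree n Y
mapLeaves f T = T >>= λ x → leaf (f x)

Everywhere : (List (Fm n) → X → Set) → List (Fm n) → CaseTree n X → Set
Everywhere P Γ (leaf x)      = P Γ x
Everywhere P Γ (split c T U) = Everywhere P (c ∷ Γ) T × Everywhere P (¬' c ∷ Γ) U

Monotone : (List (Fm n) → X → Set) → Set
Monotone P = ∀ {Γ Δ} → Γ ⊆ Δ → ∀ {x} → P Γ x → P Δ x

Everywhere-mono : {P : List (Fm n) → X → Set} → Monotone P →
                  ∀ T → Γ ⊆ Δ → Everywhere P Γ T → Everywhere P Δ T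
Everywhere-mono mono (leaf x)      Γ⊆Δ Px        = mono Γ⊆Δ Px
Everywhere-mono mono (split c T U) Γ⊆Δ (PT , PU) =
  Everywhere-mono mono T (∷⁺ʳ _ Γ⊆Δ) PT , Everywhere-mono mono U (∷⁺ʳ _ Γ⊆Δ) PU

Everywhere->>= : {P : List (Fm n) → X → Set} {Q : List (Fm n) → Y → Set} →
                 ∀ T {f : X → CaseTree n Y} → Everywhere P Γ T →
                 (∀ {Δ} → Γ ⊆ Δ → ∀ {x} → P Δ x → Everywhere Q Δ (f x)) → Everywhere Q Γ (T >>= f)
Everywhere->>= (leaf x)      Px        hf = hf id Px
Everywhere->>= (split c T U) (PT , PU) hf =
  Everywhere->>= T PT (λ Γ⊆Δ → hf (Γ⊆Δ ∘ there)) , Everywhere->>= U PU (λ Γ⊆Δ → hf (Γ⊆Δ ∘ there))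

Everywhere-bind₂ : {P₁ : List (Fm n) → X → Set} {P₂ : List (Fm n) → Y → Set} {Q : List (Fm n) → Z → Set} →
                   Monotone P₁ → Monotone P₂ → ∀ {f : X → Y → CaseTree n Z} T U →
                   Everywhere P₁ Γ T → Everywhere P₂ Γ U →
                   (∀ {Δ x y} → P₁ Δ x → P₂ Δ y → Everywhere Q Δ (f x y)) → Everywhere Q Γ (bind₂ f T U)
Everywhere-bind₂ mono₁ mono₂ T U PT PU hf =
  Everywhere->>= T PT λ Γ⊆Δ Px →
    Everywhere->>= U (Everywhere-mono mono₂ U Γ⊆Δ PU) λ Δ⊆Δ′ Py → hf (mono₁ Δ⊆Δ′ Px) Py

flatten : CaseTree n (Fm n) → Fm n
flatten (leaf φ)      = φ
flatten (split c T U) = (c ∧' flatten T) ∨' (¬' c ∧' flatten U)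

Equivalent : Fm n → List (Fm n) → Fm n → Set
Equivalent φ Γ ψ = Γ ⊢ φ ⟺ ψ

flatten-⟺ : ∀ T → Everywhere (Equivalent φ) Γ T → Γ ⊢ φ ⟺ flatten T
flatten-⟺ (leaf ψ)      φ⟺ψ       = φ⟺ψ
flatten-⟺ {φ = φ} {Γ = Γ} (split c T U) (φ⟺T , φ⟺U) = ⟺I
  (by-cases c (∨I₁ (∧I hyp₀ (⟺E₁ (under-case T φ⟺T) (wk hyp₀))))
              (∨I₂ (∧I hyp₀ (⟺E₁ (under-case U φ⟺U) (wk hyp₀)))))
  (∨E hyp₀ (cut (∧E₁ hyp₀) (⟺E₂ (in-case T φ⟺T) (∧E₂ (wk hyp₀))))
           (cut (∧E₁ hyp₀) (⟺E₂ (in-case U φ⟺U) (∧E₂ (wk hyp₀)))))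
  where
  under-case : ∀ {ψ χ} T → Everywhere (Equivalent φ) (χ ∷ Γ) T → (χ ∷ ψ ∷ Γ) ⊢ φ ⟺ flatten T
  under-case T φ⟺T = ⊢-mono (∷⁺ʳ _ (xs⊆x∷xs Γ _)) (flatten-⟺ T φ⟺T)
  in-case : ∀ {ψ χ ξ} T → Everywhere (Equivalent φ) (χ ∷ Γ) T → (χ ∷ ψ ∷ ξ ∷ Γ) ⊢ φ ⟺ flatten T
  in-case T φ⟺T = ⊢-mono (∷⁺ʳ _ (there ∘ xs⊆x∷xs Γ _)) (flatten-⟺ T φ⟺T)

Fraction : ℕ → Set
Fraction n = Tm n × Tm n

Represents : Tm n → List (Fm n) → Fraction n → Set
Represents t Γ (p , q) = (Γ ⊢ ¬' (q ≐ c0)) × (Γ ⊢ q ⊗ t ≐ p)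

Represents-mono : Monotone (Represents t)
Represents-mono Γ⊆Δ (q≉0 , qt≐p) = ⊢-mono Γ⊆Δ q≉0 , ⊢-mono Γ⊆Δ qt≐p

Represents-self : Represents t Γ (t , c1)
Represents-self {t = t} = 1≉0 , ≐-trans (⊗-comm c1 t) (⊗-identityʳ t)

Represents-zero : Γ ⊢ t ≐ c0 → Represents t Γ (c0 , c1)
Represents-zero {t = t} t≐0 = 1≉0 , ≐-trans (⊗-comm c1 t) (≐-trans (⊗-identityʳ t) t≐0)

Represents-⊘ : ∀ {α γ : Tm n} → Γ ⊢ Ap γ → Γ ⊢ t ≐ α ⊘ γ → Represents t Γ (α , γ)
Represents-⊘ Aγ t≐α/γ = Ap-≉0 Aγ , ≐-trans (⊗-cong ≐-refl t≐α/γ) (⊗-⊘-cancel (Ap-≉0 Aγ))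

Represents-bind₂ : {Q : List (Fm n) → Z → Set} → ∀ {f : Fraction n → Fraction n → CaseTree n Z} T U →
                   Everywhere (Represents s) Γ T → Everywhere (Represents t) Γ U →
                   (∀ {Δ x y} → Represents s Δ x → Represents t Δ y → Everywhere Q Δ (f x y)) →
                   Everywhere Q Γ (bind₂ f T U)
Represents-bind₂ = Everywhere-bind₂ Represents-mono Represents-mono

-- p/q = pq/q², whose denominator is positive.
0≺denominator² : ∀ {p q : Tm n} → Represents t Γ (p , q) → Γ ⊢ c0 ≺ q ⊗ q
0≺denominator² {q = q} (q≉0 , _) = 0≺square q q≉0

denominator²-⊗ : ∀ {p q : Tm n} → Represents t Γ (p , q) → Γ ⊢ (q ⊗ q) ⊗ t ≐ p ⊗ q
denominator²-⊗ {t = t} {p = p} {q} (_ , qt≐p) =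
  ≐-trans (⊗-assoc q q t) (≐-trans (⊗-cong ≐-refl qt≐p) (⊗-comm q p))

_+ᶠ_ _-ᶠ_ _*ᶠ_ : Fraction n → Fraction n → Fraction n
(p , q) +ᶠ (p′ , q′) = (p ⊗ q′ ⊕ p′ ⊗ q , q ⊗ q′)
(p , q) -ᶠ (p′ , q′) = (p ⊗ q′ ⊖ p′ ⊗ q , q ⊗ q′)
(p , q) *ᶠ (p′ , q′) = (p ⊗ p′ , q ⊗ q′)

_/ᶠ_ : Fraction n → Fraction n → CaseTree n (Fraction n)
(p , q) /ᶠ (p′ , q′) = split (p′ ≐ c0) (leaf (c0 , c1)) (leaf (p ⊗ q′ , q ⊗ p′))

lam-of-ratio : Tm n → Tm n → CaseTree n (Fraction n)
lam-of-ratio P Q =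
  split (c0 ≺ P)
    (split ((Q ⊗ lam P) ≼ (P ⊗ lam Q)) (leaf (lam P , lam Q)) (leaf (lam P , two ⊗ lam Q)))
    (leaf (c0 , c1))

lamᶠ : Fraction n → CaseTree n (Fraction n)
lamᶠ (p , q) = lam-of-ratio (p ⊗ q) (q ⊗ q)

fraction : Tm n → CaseTree n (Fraction n)
fraction (var i) = leaf (var i , c1)
fraction c0      = leaf (c0 , c1)
fraction c1      = leaf (c1 , c1)
fraction (s ⊕ t) = mapLeaves₂ _+ᶠ_ (fraction s) (fraction t)
fraction (s ⊖ t) = mapLeaves₂ _-ᶠ_ (fraction s) (fraction t)
fraction (s ⊗ t) = mapLeaves₂ _*ᶠ_ (fraction s) (fraction t)
fraction (s ⊘ t) = bind₂ _/ᶠ_ (fraction s) (fraction t)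
fraction (lam t) = fraction t >>= lamᶠ

+ᶠ-correct : ∀ x y → Represents s Γ x → Represents t Γ y → Represents (s ⊕ t) Γ (x +ᶠ y)
+ᶠ-correct {s = s} {Γ = Γ} {t = t} (p , q) (p′ , q′) (q≉0 , qs≐p) (q′≉0 , q′t≐p′) =
  ⊗-≉0 q≉0 q′≉0 ,
  ≐-trans (solve 4 (λ q q′ s t → (q :* q′) :* (s :+ t) := (q :* s) :* q′ :+ (q′ :* t) :* q) ≐-refl q q′ s t)
          (⊕-cong (⊗-cong qs≐p ≐-refl) (⊗-cong q′t≐p′ ≐-refl))
  where open TermSemiring Γ

-ᶠ-correct : ∀ x y → Represents s Γ x → Represents t Γ y → Represents (s ⊖ t) Γ (x -ᶠ y)
-ᶠ-correct {s = s} {Γ = Γ} {t = t} (p , q) (p′ , q′) (q≉0 , qs≐p) (q′≉0 , q′t≐p′) =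
  ⊗-≉0 q≉0 q′≉0 ,
  ≐-trans (⊗-distribˡ-⊖ (q ⊗ q′) s t)
    (⊖-cong (≐-trans (solve 3 (λ q q′ s → (q :* q′) :* s := (q :* s) :* q′) ≐-refl q q′ s)
                     (⊗-cong qs≐p ≐-refl))
            (≐-trans (solve 3 (λ q q′ t → (q :* q′) :* t := (q′ :* t) :* q) ≐-refl q q′ t)
                     (⊗-cong q′t≐p′ ≐-refl)))
  where open TermSemiring Γ

*ᶠ-correct : ∀ x y → Represents s Γ x → Represents t Γ y → Represents (s ⊗ t) Γ (x *ᶠ y)
*ᶠ-correct {s = s} {Γ = Γ} {t = t} (p , q) (p′ , q′) (q≉0 , qs≐p) (q′≉0 , q′t≐p′) =
  ⊗-≉0 q≉0 q′≉0 ,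
  ≐-trans (solve 4 (λ q q′ s t → (q :* q′) :* (s :* t) := (q :* s) :* (q′ :* t)) ≐-refl q q′ s t)
          (⊗-cong qs≐p q′t≐p′)
  where open TermSemiring Γ

/ᶠ-correct : ∀ x y → Represents s Γ x → Represents t Γ y → Everywhere (Represents (s ⊘ t)) Γ (x /ᶠ y)
/ᶠ-correct {s = s} {Γ = Γ} {t = t} (p , q) (p′ , q′) (q≉0 , qs≐p) (q′≉0 , q′t≐p′) =
  Represents-zero (⊘-zero t≐0) ,
  (⊗-≉0 (wk q≉0) hyp₀ , quotient)
  where
  Γ′ : List (Fm _)
  Γ′ = ¬' (p′ ≐ c0) ∷ Γ
  open TermSemiring Γ′
  t≐0 : ((p′ ≐ c0) ∷ Γ) ⊢ t ≐ c0
  t≐0 = ⊗-cancelˡ (wk q′≉0) (≐-trans (wk q′t≐p′) (≐-trans hyp₀ (≐-sym (⊗-zeroʳ q′))))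
  t≉0 : Γ′ ⊢ ¬' (t ≐ c0)
  t≉0 = ¬I (¬E (wk hyp₀) (≐-trans (≐-sym (wk (wk q′t≐p′))) (≐-trans (⊗-cong ≐-refl hyp₀) (⊗-zeroʳ q′))))
  quotient : Γ′ ⊢ (q ⊗ p′) ⊗ (s ⊘ t) ≐ p ⊗ q′
  quotient = begin
    (q ⊗ p′) ⊗ (s ⊘ t)        ≈⟨ ⊗-cong (⊗-cong ≐-refl (≐-sym (wk q′t≐p′))) ≐-refl ⟩
    (q ⊗ (q′ ⊗ t)) ⊗ (s ⊘ t)  ≈⟨ solve 4 (λ q q′ t d → (q :* (q′ :* t)) :* d := q′ :* (q :* (t :* d)))
                                         ≐-refl q q′ t (s ⊘ t) ⟩
    q′ ⊗ (q ⊗ (t ⊗ (s ⊘ t)))  ≈⟨ ⊗-cong ≐-refl (⊗-cong ≐-refl (⊗-⊘-cancel t≉0)) ⟩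
    q′ ⊗ (q ⊗ s)              ≈⟨ ⊗-cong ≐-refl (wk qs≐p) ⟩
    q′ ⊗ p                    ≈⟨ ⊗-comm q′ p ⟩
    p ⊗ q′                    ∎

lam-of-ratio-correct : ∀ {P Q : Tm n} → Γ ⊢ c0 ≺ Q → Γ ⊢ Q ⊗ s ≐ P →
                       Everywhere (Represents (lam s)) Γ (lam-of-ratio P Q)
lam-of-ratio-correct {Γ = Γ} {s = s} {P = P} {Q} 0<Q Qs≐P = (below , above) , nonpositive
  where
  C : Fm _
  C = (Q ⊗ lam P) ≼ (P ⊗ lam Q)
  Γ₊ : List (Fm _)
  Γ₊ = (c0 ≺ P) ∷ Γ
  0<Q₊ : ∀ {χ} → (χ ∷ Γ₊) ⊢ c0 ≺ Q
  0<Q₊ = wk (wk 0<Q)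
  Qs≐P₊ : ∀ {χ} → (χ ∷ Γ₊) ⊢ Q ⊗ s ≐ P
  Qs≐P₊ = wk (wk Qs≐P)
  0<P₊ : ∀ {χ} → (χ ∷ Γ₊) ⊢ c0 ≺ P
  0<P₊ = wk hyp₀
  below : Represents (lam s) (C ∷ Γ₊) (lam P , lam Q)
  below = Represents-⊘ (Ap-lam 0<Q₊) (lam-ratio-≼ 0<P₊ 0<Q₊ Qs≐P₊ hyp₀)
  above : Represents (lam s) (¬' C ∷ Γ₊) (lam P , two ⊗ lam Q)
  above = Represents-⊘ (Ap-⊗ Ap-two (Ap-lam 0<Q₊)) (lam-ratio-≻ 0<P₊ 0<Q₊ Qs≐P₊ hyp₀)
  s≯0 : (¬' (c0 ≺ P) ∷ Γ) ⊢ ¬' (c0 ≺ s)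
  s≯0 = ¬I (¬E (wk hyp₀) (≺-respʳ (wk (wk Qs≐P)) (0≺⊗ (wk (wk 0<Q)) hyp₀)))
  nonpositive : Represents (lam s) (¬' (c0 ≺ P) ∷ Γ) (c0 , c1)
  nonpositive = Represents-zero (lam-of-nonpos s≯0)

lamᶠ-correct : ∀ x → Represents s Γ x → Everywhere (Represents (lam s)) Γ (lamᶠ x)
lamᶠ-correct (p , q) rep = lam-of-ratio-correct (0≺denominator² rep) (denominator²-⊗ rep)

fraction-correct : ∀ (t : Tm n) → Everywhere (Represents t) Γ (fraction t)
fraction-correct (var i) = Represents-self
fraction-correct c0      = Represents-self
fraction-correct c1      = Represents-self
fraction-correct (s ⊕ t) = Represents-bind₂ (fraction s) (fraction t)
  (fraction-correct s) (fraction-correct t) (+ᶠ-correct _ _)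
fraction-correct (s ⊖ t) = Represents-bind₂ (fraction s) (fraction t)
  (fraction-correct s) (fraction-correct t) (-ᶠ-correct _ _)
fraction-correct (s ⊗ t) = Represents-bind₂ (fraction s) (fraction t)
  (fraction-correct s) (fraction-correct t) (*ᶠ-correct _ _)
fraction-correct (s ⊘ t) = Represents-bind₂ (fraction s) (fraction t)
  (fraction-correct s) (fraction-correct t) (/ᶠ-correct _ _)
fraction-correct (lam t) = Everywhere->>= (fraction t) (fraction-correct t) (λ _ → lamᶠ-correct _)

-- x ≺ᶠ y is s ≺ t multiplied through by (q q′)², which is positive.
_≐ᶠ_ _≺ᶠ_ : Fraction n → Fraction n → Fm n
(p , q) ≐ᶠ (p′ , q′) = p ⊗ q′ ≐ p′ ⊗ q
(p , q) ≺ᶠ (p′ , q′) = (q ⊗ (q′ ⊗ q′)) ⊗ p ≺ (q′ ⊗ (q ⊗ q)) ⊗ p′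

Apᶠ : Fraction n → Fm n
Apᶠ (p , q) = RatioInA (p ⊗ q) (q ⊗ q)

Dpᶠ : ℕ → Fraction n → Fm n
Dpᶠ k (p , q) = Apᶠ (p , q) ∧' Dp k (pow (lam (q ⊗ q)) k ⊗ lam (p ⊗ q))

≐ᶠ-correct : ∀ x y → Represents s Γ x → Represents t Γ y → Γ ⊢ (s ≐ t) ⟺ (x ≐ᶠ y)
≐ᶠ-correct {s = s} {Γ = Γ} {t = t} (p , q) (p′ , q′) (q≉0 , qs≐p) (q′≉0 , q′t≐p′) = ⟺I forward backward
  where
  forward : ((s ≐ t) ∷ Γ) ⊢ p ⊗ q′ ≐ p′ ⊗ q
  forward = begin
    p ⊗ q′         ≈⟨ ⊗-cong (≐-sym (wk qs≐p)) ≐-refl ⟩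
    (q ⊗ s) ⊗ q′   ≈⟨ ⊗-cong (⊗-cong ≐-refl hyp₀) ≐-refl ⟩
    (q ⊗ t) ⊗ q′   ≈⟨ solve 3 (λ q t q′ → (q :* t) :* q′ := (q′ :* t) :* q) ≐-refl q t q′ ⟩
    (q′ ⊗ t) ⊗ q   ≈⟨ ⊗-cong (wk q′t≐p′) ≐-refl ⟩
    p′ ⊗ q         ∎
    where open TermSemiring ((s ≐ t) ∷ Γ)
  backward : ((p ⊗ q′ ≐ p′ ⊗ q) ∷ Γ) ⊢ s ≐ t
  backward = ⊗-cancelˡ (wk (⊗-≉0 q≉0 q′≉0)) (begin
    (q ⊗ q′) ⊗ s   ≈⟨ solve 3 (λ q q′ s → (q :* q′) :* s := (q :* s) :* q′) ≐-refl q q′ s ⟩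
    (q ⊗ s) ⊗ q′   ≈⟨ ⊗-cong (wk qs≐p) ≐-refl ⟩
    p ⊗ q′         ≈⟨ hyp₀ ⟩
    p′ ⊗ q         ≈⟨ ⊗-cong (≐-sym (wk q′t≐p′)) ≐-refl ⟩
    (q′ ⊗ t) ⊗ q   ≈⟨ solve 3 (λ q q′ t → (q′ :* t) :* q := (q :* q′) :* t) ≐-refl q q′ t ⟩
    (q ⊗ q′) ⊗ t   ∎)
    where open TermSemiring ((p ⊗ q′ ≐ p′ ⊗ q) ∷ Γ)

≺ᶠ-correct : ∀ x y → Represents s Γ x → Represents t Γ y → Γ ⊢ (s ≺ t) ⟺ (x ≺ᶠ y)
≺ᶠ-correct {s = s} {Γ = Γ} {t = t} (p , q) (p′ , q′) (q≉0 , qs≐p) (q′≉0 , q′t≐p′) = ⟺I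
  (≺-resp (wk Ks) (wk Kt) (⊗-monoʳ-≺ (wk 0<K) hyp₀))
  (⊗-cancelˡ-≺ (wk 0<K) (≺-resp (≐-sym (wk Ks)) (≐-sym (wk Kt)) hyp₀))
  where
  open TermSemiring Γ
  K : Tm _
  K = (q ⊗ q′) ⊗ (q ⊗ q′)
  0<K : Γ ⊢ c0 ≺ K
  0<K = 0≺square (q ⊗ q′) (⊗-≉0 q≉0 q′≉0)
  Ks : Γ ⊢ K ⊗ s ≐ (q ⊗ (q′ ⊗ q′)) ⊗ p
  Ks = ≐-trans (solve 3 (λ q q′ s → ((q :* q′) :* (q :* q′)) :* s := (q :* (q′ :* q′)) :* (q :* s)) ≐-refl q q′ s)
               (⊗-cong ≐-refl qs≐p)
  Kt : Γ ⊢ K ⊗ t ≐ (q′ ⊗ (q ⊗ q)) ⊗ p′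
  Kt = ≐-trans (solve 3 (λ q q′ t → ((q :* q′) :* (q :* q′)) :* t := (q′ :* (q :* q)) :* (q′ :* t)) ≐-refl q q′ t)
               (⊗-cong ≐-refl q′t≐p′)

Apᶠ-correct : ∀ x → Represents s Γ x → Γ ⊢ Ap s ⟺ Apᶠ x
Apᶠ-correct (p , q) rep = Ap-ratio (0≺denominator² rep) (denominator²-⊗ rep)

Dpᶠ-correct : ∀ k x → Represents s Γ x → Γ ⊢ Dp k s ⟺ Dpᶠ k x
Dpᶠ-correct k (p , q) rep = Dp-ratio k (0≺denominator² rep) (denominator²-⊗ rep)

¬'-cong : Γ ⊢ φ ⟺ φ′ → Γ ⊢ (¬' φ) ⟺ (¬' φ′)
¬'-cong e = ⟺I (¬I (¬E (wk hyp₀) (⟺E₂ (wk (wk e)) hyp₀))) (¬I (¬E (wk hyp₀) (⟺E₁ (wk (wk e)) hyp₀)))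

∧'-cong : Γ ⊢ φ ⟺ φ′ → Γ ⊢ ψ ⟺ ψ′ → Γ ⊢ (φ ∧' ψ) ⟺ (φ′ ∧' ψ′)
∧'-cong e f = ⟺I (∧I (⟺E₁ (wk e) (∧E₁ hyp₀)) (⟺E₁ (wk f) (∧E₂ hyp₀)))
                 (∧I (⟺E₂ (wk e) (∧E₁ hyp₀)) (⟺E₂ (wk f) (∧E₂ hyp₀)))

∨'-cong : Γ ⊢ φ ⟺ φ′ → Γ ⊢ ψ ⟺ ψ′ → Γ ⊢ (φ ∨' ψ) ⟺ (φ′ ∨' ψ′)
∨'-cong e f = ⟺I (∨E hyp₀ (∨I₁ (⟺E₁ (wk (wk e)) hyp₀)) (∨I₂ (⟺E₁ (wk (wk f)) hyp₀)))
                 (∨E hyp₀ (∨I₁ (⟺E₂ (wk (wk e)) hyp₀)) (∨I₂ (⟺E₂ (wk (wk f)) hyp₀)))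

⟶-cong : Γ ⊢ φ ⟺ φ′ → Γ ⊢ ψ ⟺ ψ′ → Γ ⊢ (φ ⟶ ψ) ⟺ (φ′ ⟶ ψ′)
⟶-cong e f = ⟺I (⟶I (⟺E₁ (wk (wk f)) (⟶E (wk hyp₀) (⟺E₂ (wk (wk e)) hyp₀))))
                (⟶I (⟺E₂ (wk (wk f)) (⟶E (wk hyp₀) (⟺E₁ (wk (wk e)) hyp₀))))

⟺-cong : Γ ⊢ φ ⟺ φ′ → Γ ⊢ ψ ⟺ ψ′ → Γ ⊢ (φ ⟺ ψ) ⟺ (φ′ ⟺ ψ′)
⟺-cong e f = ⟺I
  (⟺I (⟺E₁ (wk (wk f)) (⟺E₁ (wk hyp₀) (⟺E₂ (wk (wk e)) hyp₀)))
      (⟺E₁ (wk (wk e)) (⟺E₂ (wk hyp₀) (⟺E₂ (wk (wk f)) hyp₀))))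
  (⟺I (⟺E₂ (wk (wk f)) (⟺E₁ (wk hyp₀) (⟺E₁ (wk (wk e)) hyp₀)))
      (⟺E₂ (wk (wk e)) (⟺E₂ (wk hyp₀) (⟺E₁ (wk (wk f)) hyp₀))))

⟺-refl : Γ ⊢ φ ⟺ φ
⟺-refl = ⟺I hyp₀ hyp₀

elim-div : {φ : Fm n} → QF φ → Fm n
elim-div q⊤'         = ⊤'
elim-div q⊥'         = ⊥'
elim-div (q≐ s t)    = flatten (mapLeaves₂ _≐ᶠ_ (fraction s) (fraction t))
elim-div (q≺ s t)    = flatten (mapLeaves₂ _≺ᶠ_ (fraction s) (fraction t))
elim-div (qAp t)     = flatten (mapLeaves Apᶠ (fraction t))
elim-div (qDp k t)   = flatten (mapLeaves (Dpᶠ k) (fraction t))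
elim-div (q¬' φ)     = ¬' elim-div φ
elim-div (q∧' φ ψ)   = elim-div φ ∧' elim-div ψ
elim-div (q∨' φ ψ)   = elim-div φ ∨' elim-div ψ
elim-div (q⟶ φ ψ)    = elim-div φ ⟶ elim-div ψ
elim-div (q⟺ φ ψ)    = elim-div φ ⟺ elim-div ψ

elim-div-⟺ : (qf : QF φ) → Γ ⊢ φ ⟺ elim-div qf
elim-div-⟺ q⊤'       = ⟺-refl
elim-div-⟺ q⊥'       = ⟺-refl
elim-div-⟺ (q≐ s t)  = flatten-⟺ (mapLeaves₂ _≐ᶠ_ (fraction s) (fraction t))
  (Represents-bind₂ (fraction s) (fraction t)
    (fraction-correct s) (fraction-correct t) (≐ᶠ-correct _ _))
elim-div-⟺ (q≺ s t)  = flatten-⟺ (mapLeaves₂ _≺ᶠ_ (fraction s) (fraction t))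
  (Represents-bind₂ (fraction s) (fraction t)
    (fraction-correct s) (fraction-correct t) (≺ᶠ-correct _ _))
elim-div-⟺ (qAp t)   = flatten-⟺ (mapLeaves Apᶠ (fraction t))
  (Everywhere->>= (fraction t) (fraction-correct t) (λ _ → Apᶠ-correct _))
elim-div-⟺ (qDp k t) = flatten-⟺ (mapLeaves (Dpᶠ k) (fraction t))
  (Everywhere->>= (fraction t) (fraction-correct t) (λ _ → Dpᶠ-correct k _))
elim-div-⟺ (q¬' φ)   = ¬'-cong (elim-div-⟺ φ)
elim-div-⟺ (q∧' φ ψ) = ∧'-cong (elim-div-⟺ φ) (elim-div-⟺ ψ)
elim-div-⟺ (q∨' φ ψ) = ∨'-cong (elim-div-⟺ φ) (elim-div-⟺ ψ)
elim-div-⟺ (q⟶ φ ψ)  = ⟶-cong (elim-div-⟺ φ) (elim-div-⟺ ψ)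
elim-div-⟺ (q⟺ φ ψ)  = ⟺-cong (elim-div-⟺ φ) (elim-div-⟺ ψ)

2^-mono : ∀ {a b} → a ≤ b → 2 ^ a ≤ 2 ^ b
2^-mono = ^-monoʳ-≤ 2

2^-double : ∀ C → 2 ^ C + 2 ^ C ≡ 2 ^ suc C
2^-double C = cong (2 ^ C +_) (sym (+-identityʳ (2 ^ C)))

<2^-node : ∀ {a b} C → a < 2 ^ C → b < 2 ^ C → suc (a + b) < 2 ^ suc C
<2^-node {a} {b} C a< b< = begin-strict
  suc (a + b)     <⟨ s≤s (≤-reflexive (sym (+-suc a b))) ⟩
  suc a + suc b   ≤⟨ +-mono-≤ a< b< ⟩
  2 ^ C + 2 ^ C   ≡⟨ 2^-double C ⟩
  2 ^ suc C       ∎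
  where open ≤-Reasoning

n<2^n : ∀ k → k < 2 ^ k
n<2^n zero    = s≤s z≤n
n<2^n (suc k) = <2^-node {0} k (m^n>0 2 k) (n<2^n k)

record SmallT (C : ℕ) (t : Tm n) : Set where
  constructor small
  field
    length<       : lenT t < 2 ^ C
    division-free : DivFreeT t

record SmallF (C : ℕ) (φ : Fm n) : Set where
  constructor small
  field
    length<         : len φ < 2 ^ C
    quantifier-free : QF φ
    division-free   : DivFree φ

SmallPair : ℕ → Fraction n → Set
SmallPair C (p , q) = SmallT C p × SmallT C q

SmallT-mono : ∀ {C D} {t : Tm n} → C ≤ D → SmallT C t → SmallT D t
SmallT-mono C≤D (small l d) = small (<-≤-trans l (2^-mono C≤D)) d

SmallF-mono : ∀ {C D} {φ : Fm n} → C ≤ D → SmallF C φ → SmallF D φ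
SmallF-mono C≤D (small l q d) = small (<-≤-trans l (2^-mono C≤D)) q d

SmallPair-mono : ∀ {C D} {x : Fraction n} → C ≤ D → SmallPair C x → SmallPair D x
SmallPair-mono C≤D (p , q) = SmallT-mono C≤D p , SmallT-mono C≤D q

1<2^suc : ∀ C → 1 < 2 ^ suc C
1<2^suc C = <2^-node {0} {0} C (m^n>0 2 C) (m^n>0 2 C)

small-var : ∀ C (i : Fin n) → SmallT (suc C) (var i)
small-var C i = small (1<2^suc C) (qvar i)

small-c0 : ∀ C → SmallT {n} (suc C) c0
small-c0 C = small (1<2^suc C) qc0

small-c1 : ∀ C → SmallT {n} (suc C) c1
small-c1 C = small (1<2^suc C) qc1

small-⊕ : ∀ {C} → SmallT C a → SmallT C b → SmallT (suc C) (a ⊕ b)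
small-⊕ {C = C} (small la da) (small lb db) = small (<2^-node C la lb) (q⊕ da db)

small-⊖ : ∀ {C} → SmallT C a → SmallT C b → SmallT (suc C) (a ⊖ b)
small-⊖ {C = C} (small la da) (small lb db) = small (<2^-node C la lb) (q⊖ da db)

small-⊗ : ∀ {C} → SmallT C a → SmallT C b → SmallT (suc C) (a ⊗ b)
small-⊗ {C = C} (small la da) (small lb db) = small (<2^-node C la lb) (q⊗ da db)

small-lam : ∀ {C} → SmallT C a → SmallT (suc C) (lam a)
small-lam {C = C} (small la da) = small (<2^-node {0} C (m^n>0 2 C) la) (qlam da)

small-two : ∀ C → SmallT {n} (2 + C) two
small-two C = small-⊕ (small-c1 C) (small-c1 C)

small-pow : ∀ {C} k → SmallT (suc C) a → SmallT (k + suc C) (pow a k)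
small-pow {C = C} zero    a-small = small-c1 C
small-pow {C = C} (suc k) a-small = small-⊗ (small-pow k a-small) (SmallT-mono (m≤n+m (suc C) k) a-small)

small-≐ : ∀ {C} → SmallT C a → SmallT C b → SmallF (suc C) (a ≐ b)
small-≐ {C = C} (small la da) (small lb db) = small (<2^-node C la lb) (q≐ _ _) (q≐ da db)

small-≺ : ∀ {C} → SmallT C a → SmallT C b → SmallF (suc C) (a ≺ b)
small-≺ {C = C} (small la da) (small lb db) = small (<2^-node C la lb) (q≺ _ _) (q≺ da db)

small-∧' : ∀ {C} → SmallF C φ → SmallF C ψ → SmallF (suc C) (φ ∧' ψ)
small-∧' {C = C} (small lφ qφ dφ) (small lψ qψ dψ) = small (<2^-node C lφ lψ) (q∧' qφ qψ) (q∧' dφ dψ)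

small-∨' : ∀ {C} → SmallF C φ → SmallF C ψ → SmallF (suc C) (φ ∨' ψ)
small-∨' {C = C} (small lφ qφ dφ) (small lψ qψ dψ) = small (<2^-node C lφ lψ) (q∨' qφ qψ) (q∨' dφ dψ)

small-≼ : ∀ {C} → SmallT C a → SmallT C b → SmallF (2 + C) (a ≼ b)
small-≼ a-small b-small = small-∨' (small-≺ a-small b-small) (small-≐ a-small b-small)

small-¬' : ∀ {C} → SmallF C φ → SmallF (suc C) (¬' φ)
small-¬' {C = C} (small lφ qφ dφ) = small (<2^-node {0} C (m^n>0 2 C) lφ) (q¬' qφ) (q¬' dφ)

small-⟶ : ∀ {C} → SmallF C φ → SmallF C ψ → SmallF (suc C) (φ ⟶ ψ)
small-⟶ {C = C} (small lφ qφ dφ) (small lψ qψ dψ) = small (<2^-node C lφ lψ) (q⟶ qφ qψ) (q⟶ dφ dψ)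

small-⟺ : ∀ {C} → SmallF C φ → SmallF C ψ → SmallF (suc C) (φ ⟺ ψ)
small-⟺ {C = C} (small lφ qφ dφ) (small lψ qψ dψ) = small (<2^-node C lφ lψ) (q⟺ qφ qψ) (q⟺ dφ dψ)

small-Dp : ∀ {C} k → k < 2 ^ C → SmallT C t → SmallF (suc C) (Dp k t)
small-Dp {C = C} k k< (small lt dt) = small (<2^-node C k< lt) (qDp k _) (qDp k dt)

leaves : CaseTree n X → ℕ
leaves (leaf _)      = 1
leaves (split _ T U) = leaves T + leaves U

AllNodes : (Fm n → Set) → (X → Set) → CaseTree n X → Set
AllNodes P Q (leaf x)      = Q x
AllNodes P Q (split c T U) = P c × AllNodes P Q T × AllNodes P Q U

record Bounded (L C : ℕ) (Q : ℕ → X → Set) (T : CaseTree n X) : Set where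
  constructor bounded
  field
    leaves≤ : leaves T ≤ 2 ^ L
    nodes   : AllNodes (SmallF C) (Q C) T

leaves->>= : ∀ (T : CaseTree n X) {f : X → CaseTree n Y} {Q : X → Set} {P : Fm n → Set} {k} →
             AllNodes P Q T → (∀ {x} → Q x → leaves (f x) ≤ k) → leaves (T >>= f) ≤ leaves T * k
leaves->>= (leaf x)      Qx                 bound = ≤-trans (bound Qx) (≤-reflexive (sym (+-identityʳ _)))
leaves->>= (split c T U) {k = k} (_ , QT , QU) bound = begin
  leaves (T >>= _) + leaves (U >>= _) ≤⟨ +-mono-≤ (leaves->>= T QT bound) (leaves->>= U QU bound) ⟩
  leaves T * k + leaves U * k         ≡⟨ sym (*-distribʳ-+ k (leaves T) (leaves U)) ⟩
  (leaves T + leaves U) * k           ∎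
  where open ≤-Reasoning

AllNodes->>= : ∀ (T : CaseTree n X) {f : X → CaseTree n Y} {P P′ : Fm n → Set} {Q : X → Set} {R : Y → Set} →
               (∀ {c} → P c → P′ c) → AllNodes P Q T → (∀ {x} → Q x → AllNodes P′ R (f x)) →
               AllNodes P′ R (T >>= f)
AllNodes->>= (leaf x)      P⇒P′ Qx           hf = hf Qx
AllNodes->>= (split c T U) P⇒P′ (Pc , QT , QU) hf =
  P⇒P′ Pc , AllNodes->>= T P⇒P′ QT hf , AllNodes->>= U P⇒P′ QU hf

Bounded->>= : ∀ {L L′ C C′} {Q : ℕ → X → Set} {R : ℕ → Y → Set} (T : CaseTree n X) {f : X → CaseTree n Y} →
              C ≤ C′ → Bounded L C Q T → (∀ {x} → Q C x → Bounded L′ C′ R (f x)) → Bounded (L + L′) C′ R (T >>= f)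
Bounded->>= {L = L} {L′} T C≤C′ (bounded leavesT nodesT) hf = bounded
  (≤-trans (leaves->>= T nodesT (Bounded.leaves≤ ∘ hf))
           (≤-trans (*-mono-≤ leavesT ≤-refl) (≤-reflexive (sym (^-distribˡ-+-* 2 L L′)))))
  (AllNodes->>= T (SmallF-mono C≤C′) nodesT (Bounded.nodes ∘ hf))

Bounded-mono : ∀ {L L′ C C′} {Q : ℕ → X → Set} → (∀ {C C′ x} → C ≤ C′ → Q C x → Q C′ x) →
               ∀ (T : CaseTree n X) → L ≤ L′ → C ≤ C′ → Bounded L C Q T → Bounded L′ C′ Q T
Bounded-mono {C = C} {C′} {Q = Q} Q-mono T L≤L′ C≤C′ (bounded leavesT nodesT) =
  bounded (≤-trans leavesT (2^-mono L≤L′)) (AllNodes-mono T nodesT)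
  where
  AllNodes-mono : ∀ T → AllNodes (SmallF C) (Q C) T → AllNodes (SmallF C′) (Q C′) T
  AllNodes-mono (leaf x)      Qx               = Q-mono C≤C′ Qx
  AllNodes-mono (split c T U) (Pc , QT , QU)   = SmallF-mono C≤C′ Pc , AllNodes-mono T QT , AllNodes-mono U QU

Bounded-bind₂ : ∀ {L₁ L₂ L₃ C C′} {Q : ℕ → X → Set} {R : ℕ → Y → Set} {S : ℕ → Z → Set} →
                ∀ (T : CaseTree n X) (U : CaseTree n Y) {f : X → Y → CaseTree n Z} → C ≤ C′ →
                Bounded L₁ C Q T → Bounded L₂ C R U →
                (∀ {x y} → Q C x → R C y → Bounded L₃ C′ S (f x y)) → Bounded (L₁ + (L₂ + L₃)) C′ S (bind₂ f T U)
Bounded-bind₂ T U C≤C′ bT bU hf = Bounded->>= T C≤C′ bT λ Qx → Bounded->>= U C≤C′ bU λ Ry → hf Qx Ry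

leaf-bounded : ∀ {L C} {Q : ℕ → X → Set} {x : X} → Q C x → Bounded {n = n} L C Q (leaf x)
leaf-bounded {L = L} Qx = bounded (m^n>0 2 L) Qx

+ᶠ-bounded : ∀ {C} (x y : Fraction n) → SmallPair C x → SmallPair C y → Bounded 0 (2 + C) SmallPair (leaf {n} (x +ᶠ y))
+ᶠ-bounded _ _ (p , q) (p′ , q′) = leaf-bounded
  (small-⊕ (small-⊗ p q′) (small-⊗ p′ q) , SmallT-mono (n≤1+n _) (small-⊗ q q′))

-ᶠ-bounded : ∀ {C} (x y : Fraction n) → SmallPair C x → SmallPair C y → Bounded 0 (2 + C) SmallPair (leaf {n} (x -ᶠ y))
-ᶠ-bounded _ _ (p , q) (p′ , q′) = leaf-bounded
  (small-⊖ (small-⊗ p q′) (small-⊗ p′ q) , SmallT-mono (n≤1+n _) (small-⊗ q q′))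

*ᶠ-bounded : ∀ {C} (x y : Fraction n) → SmallPair C x → SmallPair C y → Bounded 0 (2 + C) SmallPair (leaf {n} (x *ᶠ y))
*ᶠ-bounded _ _ (p , q) (p′ , q′) = leaf-bounded
  (SmallT-mono (n≤1+n _) (small-⊗ p p′) , SmallT-mono (n≤1+n _) (small-⊗ q q′))

/ᶠ-bounded : ∀ {C} (x y : Fraction n) → SmallPair C x → SmallPair C y → Bounded 1 (2 + C) SmallPair (x /ᶠ y)
/ᶠ-bounded {C = C} _ _ (p , q) (p′ , q′) = bounded ≤-refl
  (small-≐ (SmallT-mono (n≤1+n C) p′) (small-c0 C) ,
  (small-c0 (suc C) , small-c1 (suc C)) ,
  (SmallT-mono (n≤1+n _) (small-⊗ p q′) , SmallT-mono (n≤1+n _) (small-⊗ q p′)))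

lamᶠ-bounded : ∀ {C} (x : Fraction n) → SmallPair C x → Bounded 2 (5 + C) SmallPair (lamᶠ x)
lamᶠ-bounded {C = C} (p , q) (p-small , q-small) = bounded (n≤1+n 3)
  (SmallF-mono (m≤n+m _ 3) (small-≺ (small-c0 C) P) ,
  (small-≼ (small-⊗ (SmallT-mono (n≤1+n _) Q) (small-lam P)) (small-⊗ (SmallT-mono (n≤1+n _) P) (small-lam Q)) ,
   (SmallT-mono (m≤n+m _ 3) (small-lam P) , SmallT-mono (m≤n+m _ 3) (small-lam Q)) ,
   (SmallT-mono (m≤n+m _ 3) (small-lam P) , SmallT-mono (m≤n+m _ 2) (small-⊗ (small-two C) (small-lam Q)))) ,
  (small-c0 (4 + C) , small-c1 (4 + C)))
  where
  P : SmallT (suc C) (p ⊗ q)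
  P = small-⊗ p-small q-small
  Q : SmallT (suc C) (q ⊗ q)
  Q = small-⊗ q-small q-small

fraction-bounded₂ : ∀ (s t : Tm n) {L} {f : Fraction n → Fraction n → CaseTree n (Fraction n)} → L ≤ 1 →
                    Bounded (lenT s * 5) (lenT s * 5) SmallPair (fraction s) →
                    Bounded (lenT t * 5) (lenT t * 5) SmallPair (fraction t) →
                    (∀ {C} x y → SmallPair C x → SmallPair C y → Bounded L (2 + C) SmallPair (f x y)) →
                    Bounded (suc (lenT s + lenT t) * 5) (suc (lenT s + lenT t) * 5) SmallPair
                            (bind₂ f (fraction s) (fraction t))
fraction-bounded₂ s t {L} L≤1 bs bt hf =
  Bounded-mono SmallPair-mono (bind₂ _ (fraction s) (fraction t)) leaves≤ nodes≤
    (Bounded-bind₂ (fraction s) (fraction t) (m≤n+m _ 2)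
      (Bounded-mono SmallPair-mono (fraction s) ≤-refl (m≤m+n (ℓs * 5) (ℓt * 5)) bs)
      (Bounded-mono SmallPair-mono (fraction t) ≤-refl (m≤n+m (ℓt * 5) (ℓs * 5)) bt)
      (hf _ _))
  where
  open +-*-Solver
  ℓs ℓt : ℕ
  ℓs = lenT s
  ℓt = lenT t
  leaves≤ : ℓs * 5 + (ℓt * 5 + L) ≤ suc (ℓs + ℓt) * 5
  leaves≤ = ≤-trans (+-monoʳ-≤ (ℓs * 5) (+-monoʳ-≤ (ℓt * 5) L≤1)) (≤-trans (≤-reflexive (solve 2 (λ a b → a :* con 5 :+ (b :* con 5 :+ con 1) := con 1 :+ (a :+ b) :* con 5) refl ℓs ℓt))
                    (+-monoˡ-≤ ((ℓs + ℓt) * 5) (s≤s z≤n)))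
  nodes≤ : 2 + (ℓs * 5 + ℓt * 5) ≤ suc (ℓs + ℓt) * 5
  nodes≤ = ≤-trans (≤-reflexive (solve 2 (λ a b → con 2 :+ (a :* con 5 :+ b :* con 5) := con 2 :+ (a :+ b) :* con 5) refl ℓs ℓt))
                   (+-monoˡ-≤ ((ℓs + ℓt) * 5) (s≤s (s≤s z≤n)))

fraction-bounded : ∀ (t : Tm n) → Bounded (lenT t * 5) (lenT t * 5) SmallPair (fraction t)
fraction-bounded (var i) = leaf-bounded (small-var 4 i , small-c1 4)
fraction-bounded c0      = leaf-bounded (small-c0 4 , small-c1 4)
fraction-bounded c1      = leaf-bounded (small-c1 4 , small-c1 4)
fraction-bounded (s ⊕ t) = fraction-bounded₂ s t z≤n (fraction-bounded s) (fraction-bounded t) +ᶠ-bounded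
fraction-bounded (s ⊖ t) = fraction-bounded₂ s t z≤n (fraction-bounded s) (fraction-bounded t) -ᶠ-bounded
fraction-bounded (s ⊗ t) = fraction-bounded₂ s t z≤n (fraction-bounded s) (fraction-bounded t) *ᶠ-bounded
fraction-bounded (s ⊘ t) = fraction-bounded₂ s t ≤-refl (fraction-bounded s) (fraction-bounded t) /ᶠ-bounded
fraction-bounded (lam t) = Bounded-mono SmallPair-mono (fraction t >>= lamᶠ)
  (≤-trans (≤-reflexive (+-comm (lenT t * 5) 2)) (m≤n+m _ 3)) ≤-refl
  (Bounded->>= (fraction t) (m≤n+m _ 5) (fraction-bounded t) (lamᶠ-bounded _))

flatten-syntax : ∀ {C} (T : CaseTree n (Fm n)) → AllNodes (SmallF C) (SmallF C) T → QF (flatten T) × DivFree (flatten T)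
flatten-syntax (leaf φ)      (small _ qφ dφ)            = qφ , dφ
flatten-syntax (split c T U) (small _ qc dc , sT , sU) with flatten-syntax T sT | flatten-syntax U sU
... | qT , dT | qU , dU = q∨' (q∧' qc qT) (q∧' (q¬' qc) qU) , q∨' (q∧' dc dT) (q∧' (q¬' dc) dU)

-- Each split costs 4 + 2 len c ≤ 2^(2+C) symbols, which the slack 2^(2+C) per leaf pays for.
flatten-length : ∀ {C} (T : CaseTree n (Fm n)) → AllNodes (SmallF C) (SmallF C) T →
                 len (flatten T) + 2 ^ (2 + C) ≤ leaves T * 2 ^ (3 + C)
flatten-length {C = C} (leaf φ) (small lφ _ _) = begin
  len φ + 2 ^ (2 + C)         ≤⟨ +-monoˡ-≤ _ (≤-trans (<⇒≤ lφ) (2^-mono (m≤n+m C 2))) ⟩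
  2 ^ (2 + C) + 2 ^ (2 + C)   ≡⟨ 2^-double (2 + C) ⟩
  2 ^ (3 + C)                 ≡⟨ sym (+-identityʳ _) ⟩
  1 * 2 ^ (3 + C)             ∎
  where open ≤-Reasoning
flatten-length {C = C} (split c T U) (small lc _ _ , sT , sU) = begin
  suc (suc (len c + La) + suc (suc (len c) + Lb)) + S
    ≡⟨ solve 4 (λ c La Lb S → con 1 :+ (con 1 :+ (c :+ La) :+ (con 2 :+ c :+ Lb)) :+ S
                              := (con 4 :+ (c :+ c)) :+ (La :+ Lb :+ S)) refl (len c) La Lb S ⟩
  (4 + (len c + len c)) + (La + Lb + S)
    ≤⟨ +-monoˡ-≤ _ split-cost ⟩
  S + (La + Lb + S)
    ≡⟨ solve 3 (λ La Lb S → S :+ (La :+ Lb :+ S) := (La :+ S) :+ (Lb :+ S)) refl La Lb S ⟩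
  (La + S) + (Lb + S)
    ≤⟨ +-mono-≤ (flatten-length T sT) (flatten-length U sU) ⟩
  leaves T * 2 ^ (3 + C) + leaves U * 2 ^ (3 + C)
    ≡⟨ sym (*-distribʳ-+ _ (leaves T) (leaves U)) ⟩
  (leaves T + leaves U) * 2 ^ (3 + C)
    ∎
  where
  open ≤-Reasoning
  open +-*-Solver
  La Lb S : ℕ
  La = len (flatten T)
  Lb = len (flatten U)
  S = 2 ^ (2 + C)
  split-cost : 4 + (len c + len c) ≤ S
  split-cost = ≤-trans (≤-reflexive (cong (3 +_) (+-comm 1 (len c + len c))))
                       (<2^-node (suc C) (<2^-node C lc lc) (1<2^suc C))

flatten-small : ∀ {L C} (T : CaseTree n (Fm n)) → Bounded L C SmallF T → SmallF (L + (3 + C)) (flatten T)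
flatten-small {L = L} {C} T (bounded leavesT sT) = small length< (proj₁ (flatten-syntax T sT)) (proj₂ (flatten-syntax T sT))
  where
  open ≤-Reasoning
  length< : len (flatten T) < 2 ^ (L + (3 + C))
  length< = begin-strict
    len (flatten T)                  <⟨ m<m+n _ (m^n>0 2 (2 + C)) ⟩
    len (flatten T) + 2 ^ (2 + C)    ≤⟨ flatten-length T sT ⟩
    leaves T * 2 ^ (3 + C)           ≤⟨ *-monoˡ-≤ _ leavesT ⟩
    2 ^ L * 2 ^ (3 + C)              ≡⟨ sym (^-distribˡ-+-* 2 L (3 + C)) ⟩
    2 ^ (L + (3 + C))                ∎

≐ᶠ-small : ∀ {C} (x y : Fraction n) → SmallPair C x → SmallPair C y → SmallF (2 + C) (x ≐ᶠ y)
≐ᶠ-small _ _ (p , q) (p′ , q′) = small-≐ (small-⊗ p q′) (small-⊗ p′ q)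

≺ᶠ-small : ∀ {C} (x y : Fraction n) → SmallPair C x → SmallPair C y → SmallF (4 + C) (x ≺ᶠ y)
≺ᶠ-small _ _ (p , q) (p′ , q′) =
  small-≺ (small-⊗ (small-⊗ (SmallT-mono (n≤1+n _) q) (small-⊗ q′ q′)) (SmallT-mono (m≤n+m _ 2) p))
          (small-⊗ (small-⊗ (SmallT-mono (n≤1+n _) q′) (small-⊗ q q)) (SmallT-mono (m≤n+m _ 2) p′))

Apᶠ-small : ∀ {C} (x : Fraction n) → SmallPair C x → SmallF (5 + C) (Apᶠ x)
Apᶠ-small {C = C} (p , q) (p-small , q-small) =
  small-∧' (SmallF-mono (m≤n+m _ 2) (small-≺ (small-c0 C) P))
           (small-≐ (small-⊗ (SmallT-mono (n≤1+n _) Q) (small-lam P)) (small-⊗ (SmallT-mono (n≤1+n _) P) (small-lam Q)))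
  where
  P : SmallT (suc C) (p ⊗ q)
  P = small-⊗ p-small q-small
  Q : SmallT (suc C) (q ⊗ q)
  Q = small-⊗ q-small q-small

Dpᶠ-small : ∀ {C} k (x : Fraction n) → SmallPair C x → SmallF (6 + k + C) (Dpᶠ k x)
Dpᶠ-small {C = C} k (p , q) (p-small , q-small) = SmallF-mono exponent
  (small-∧' (SmallF-mono (m≤n+m _ k) (Apᶠ-small (p , q) (p-small , q-small))) (SmallF-mono Dp-exponent Dp-small))
  where
  root-small : SmallT (suc (k + (2 + C))) (pow (lam (q ⊗ q)) k ⊗ lam (p ⊗ q))
  root-small = small-⊗ (small-pow k (small-lam (small-⊗ q-small q-small)))
                       (SmallT-mono (m≤n+m _ k) (small-lam (small-⊗ p-small q-small)))
  Dp-small : SmallF (2 + (k + (2 + C))) (Dp k (pow (lam (q ⊗ q)) k ⊗ lam (p ⊗ q)))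
  Dp-small = small-Dp k (<-≤-trans (n<2^n k) (2^-mono (≤-trans (m≤m+n k (2 + C)) (n≤1+n _)))) root-small
  Dp-exponent : 2 + (k + (2 + C)) ≤ k + (5 + C)
  Dp-exponent = ≤-trans (≤-reflexive (sym (trans (+-suc k (3 + C)) (cong suc (+-suc k (2 + C))))))
                        (+-monoʳ-≤ k (n≤1+n (4 + C)))
  exponent : suc (k + (5 + C)) ≤ 6 + k + C
  exponent = ≤-reflexive (cong suc (trans (sym (+-assoc k 5 C)) (cong (_+ C) (+-comm k 5))))

atom₂-small : ∀ (s t : Tm n) {f : Fraction n → Fraction n → Fm n} →
              (∀ {C} x y → SmallPair C x → SmallPair C y → SmallF (4 + C) (f x y)) →
              SmallF (suc (lenT s + lenT t) * 10) (flatten (mapLeaves₂ f (fraction s) (fraction t)))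
atom₂-small s t hf = SmallF-mono exponent (flatten-small _
  (Bounded-bind₂ {L₃ = 0} (fraction s) (fraction t) (m≤n+m _ 4)
    (Bounded-mono SmallPair-mono (fraction s) ≤-refl (m≤m+n (ℓs * 5) (ℓt * 5)) (fraction-bounded s))
    (Bounded-mono SmallPair-mono (fraction t) ≤-refl (m≤n+m (ℓt * 5) (ℓs * 5)) (fraction-bounded t))
    (λ x-small y-small → leaf-bounded (hf _ _ x-small y-small))))
  where
  open +-*-Solver
  ℓs ℓt : ℕ
  ℓs = lenT s
  ℓt = lenT t
  exponent : ℓs * 5 + (ℓt * 5 + 0) + (3 + (4 + (ℓs * 5 + ℓt * 5))) ≤ suc (ℓs + ℓt) * 10
  exponent = ≤-trans (≤-reflexive (solve 2 (λ a b →
      a :* con 5 :+ (b :* con 5 :+ con 0) :+ (con 3 :+ (con 4 :+ (a :* con 5 :+ b :* con 5)))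
        := con 7 :+ (a :+ b) :* con 10) refl ℓs ℓt))
    (+-monoˡ-≤ ((ℓs + ℓt) * 10) (m≤m+n 7 3))

atom₁-small : ∀ (t : Tm n) {f : Fraction n → Fm n} D →
              (∀ {C} x → SmallPair C x → SmallF (D + C) (f x)) →
              SmallF (lenT t * 5 + 0 + (3 + (D + lenT t * 5))) (flatten (mapLeaves f (fraction t)))
atom₁-small t D hf =
  flatten-small _ (Bounded->>= (fraction t) (m≤n+m _ D) (fraction-bounded t) (λ x-small → leaf-bounded (hf _ x-small)))

connective-small : ∀ a b (_∙_ : Fm n → Fm n → Fm n) → (∀ {C} → SmallF C φ → SmallF C ψ → SmallF (suc C) (φ ∙ ψ)) →
                   SmallF (a * 10) φ → SmallF (b * 10) ψ → SmallF (suc (a + b) * 10) (φ ∙ ψ)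
connective-small a b _ small-∙ φ-small ψ-small = SmallF-mono (+-monoˡ-≤ ((a + b) * 10) (s≤s z≤n))
  (small-∙ (SmallF-mono (*-monoˡ-≤ 10 (m≤m+n a b)) φ-small) (SmallF-mono (*-monoˡ-≤ 10 (m≤n+m b a)) ψ-small))

elim-div-small : (qf : QF φ) → SmallF (len φ * 10) (elim-div qf)
elim-div-small q⊤'       = small (1<2^suc 9) q⊤' q⊤'
elim-div-small q⊥'       = small (1<2^suc 9) q⊥' q⊥'
elim-div-small (q≐ s t)  = atom₂-small s t λ {C} x y x-small y-small →
  SmallF-mono (+-monoˡ-≤ C (m≤m+n 2 2)) (≐ᶠ-small x y x-small y-small)
elim-div-small (q≺ s t)  = atom₂-small s t ≺ᶠ-small
elim-div-small (qAp t)   = SmallF-mono exponent (atom₁-small t 5 Apᶠ-small)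
  where
  open +-*-Solver
  exponent : lenT t * 5 + 0 + (3 + (5 + lenT t * 5)) ≤ suc (lenT t) * 10
  exponent = ≤-trans (≤-reflexive (solve 1 (λ a → a :* con 5 :+ con 0 :+ (con 3 :+ (con 5 :+ a :* con 5))
                                              := con 8 :+ a :* con 10) refl (lenT t)))
                     (+-monoˡ-≤ (lenT t * 10) (m≤m+n 8 2))
elim-div-small (qDp k t) = SmallF-mono exponent (atom₁-small t (6 + k) (Dpᶠ-small k))
  where
  open +-*-Solver
  open ≤-Reasoning
  exponent : lenT t * 5 + 0 + (3 + (6 + k + lenT t * 5)) ≤ suc (k + lenT t) * 10
  exponent = begin
    lenT t * 5 + 0 + (3 + (6 + k + lenT t * 5)) ≡⟨ solve 2 (λ k a → a :* con 5 :+ con 0 :+ (con 3 :+ (con 6 :+ k :+ a :* con 5))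
                                                      := con 9 :+ (k :+ a :* con 10)) refl k (lenT t) ⟩
    9 + (k + lenT t * 10)                       ≤⟨ +-mono-≤ (n≤1+n 9) (+-monoˡ-≤ (lenT t * 10) (m≤m*n k 10)) ⟩
    10 + (k * 10 + lenT t * 10)                 ≡⟨ cong (10 +_) (sym (*-distribʳ-+ 10 k (lenT t))) ⟩
    suc (k + lenT t) * 10                       ∎

elim-div-small {φ = ¬' φ} (q¬' qf) =
  SmallF-mono (+-monoˡ-≤ (len φ * 10) (s≤s z≤n)) (small-¬' (elim-div-small qf))
elim-div-small {φ = φ ∧' ψ} (q∧' qφ qψ) =
  connective-small (len φ) (len ψ) _∧'_ small-∧' (elim-div-small qφ) (elim-div-small qψ)
elim-div-small {φ = φ ∨' ψ} (q∨' qφ qψ) =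
  connective-small (len φ) (len ψ) _∨'_ small-∨' (elim-div-small qφ) (elim-div-small qψ)
elim-div-small {φ = φ ⟶ ψ} (q⟶ qφ qψ) =
  connective-small (len φ) (len ψ) _⟶_ small-⟶ (elim-div-small qφ) (elim-div-small qψ)
elim-div-small {φ = φ ⟺ ψ} (q⟺ qφ qψ) =
  connective-small (len φ) (len ψ) _⟺_ small-⟺ (elim-div-small qφ) (elim-div-small qψ)

lemma5p2 : Σ ℕ (λ c → ∀ {n} (φ : Fm n) → QF φ →
             Σ (Fm n) (λ φ′ → QF φ′ × DivFree φ′ × len φ′ ≤ 2 ^ (c * len φ)
                              × (n ⊢T (φ ⟺ φ′))))
lemma5p2 = 10 , λ φ qf →
  elim-div qf ,
  SmallF.quantifier-free (elim-div-small qf) ,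
  SmallF.division-free (elim-div-small qf) ,
  ≤-trans (<⇒≤ (SmallF.length< (elim-div-small qf))) (2^-mono (≤-reflexive (*-comm (len φ) 10))) ,
  elim-div-⟺ qf
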